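{- Every scattered linear ordering of $VD_*$-rank $1$ is $1$-dimensionally interpretable in $(\mathbb{N},+)$. Moreover, there exist scattered linear orderings of $VD_*$-rank $2$ that are not interpretable in $(\mathbb{N},+)$ in any dimension.
   Context: A linear ordering $(L,<)$ is $m$-dimensionally interpretable in $(\mathbb{N},+)$ if there are first-order formulas in the language $\{=,+\}$ defining a set $D\subseteq\mathbb{N}^m$, an equivalence relation $\sim$ on $D$, and a binary relation $<_*$ on $D$ compatible with $\sim$, such that $(D/{\sim},<_*)$ is isomorphic to $(L,<)$; it is interpretable if it is $m$-dimensionally interpretable for some $m\ge 1$. A linear ordering is scattered if it has no dense infinite suborder. The $VD_*$-rank: for a linear ordering $(L,<)$ define equivalence relations $\simeq_\alpha$ by transfinite recursion: $\simeq_0$ is equality; $a\simeq_{\alpha+1}b$ iff the set $\{c\in L\mid a<c<b \text{ or } b<c<a\}/{\simeq_\alpha}$ is finite; $\simeq_\lambda=\bigcup_{\beta<\lambda}\simeq_\beta$ for limit $\lambda$. The $VD_*$-rank of $(L,<)$ is the least ordinal $\alpha$ such that $L/{\simeq_\alpha}$ is finite, and $\infty$ if there is none. -}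

module Defs where

open import Level using (0ℓ)
open import Data.Nat using (ℕ; zero; suc; _+_; _<_; _≤_)
open import Data.List using (List; []; _∷_)
open import Data.List.Relation.Unary.All using (All)
open import Data.List.Relation.Unary.Any using (Any)
open import Data.Vec using (Vec; toList; _++_)
open import Data.Product using (Σ; ∃; _×_; _,_)
open import Data.Sum using (_⊎_)
open import Data.Empty using (⊥)
open import Data.Unit using (⊤)
open import Relation.Nullary using (¬_)
open import Relation.Binary.PropositionalEquality using (_≡_)
open import Relation.Binary.Structures using (IsStrictTotalOrder)

record LinOrd : Set₁ where
  field
    Carrier : Set
    _<ₗ_    : Carrier → Carrier → Set
    isSTO   : IsStrictTotalOrder _≡_ _<ₗ_

-- First-order logic in the language {=, +}, interpreted in ℕ.
-- Variables are de Bruijn indices; quantifiers bind index 0.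

data Term : Set where
  var  : ℕ → Term
  _⊕_  : Term → Term → Term

data Formula : Set where
  _≐_  : Term → Term → Formula
  ff   : Formula
  tt   : Formula
  ¬f_  : Formula → Formula
  _∧f_ : Formula → Formula → Formula
  _∨f_ : Formula → Formula → Formula
  _⇒f_ : Formula → Formula → Formula
  ∀f   : Formula → Formula
  ∃f   : Formula → Formula

Env : Set
Env = ℕ → ℕ

_∷ₑ_ : ℕ → Env → Env
(a ∷ₑ ρ) zero    = a
(a ∷ₑ ρ) (suc i) = ρ i

evalT : Env → Term → ℕ
evalT ρ (var i) = ρ i
evalT ρ (s ⊕ t) = evalT ρ s + evalT ρ t

Sat : Formula → Env → Set
Sat (s ≐ t)  ρ = evalT ρ s ≡ evalT ρ t
Sat ff       ρ = ⊥
Sat tt       ρ = ⊤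
Sat (¬f φ)   ρ = ¬ Sat φ ρ
Sat (φ ∧f ψ) ρ = Sat φ ρ × Sat ψ ρ
Sat (φ ∨f ψ) ρ = Sat φ ρ ⊎ Sat ψ ρ
Sat (φ ⇒f ψ) ρ = Sat φ ρ → Sat ψ ρ
Sat (∀f φ)   ρ = (a : ℕ) → Sat φ (a ∷ₑ ρ)
Sat (∃f φ)   ρ = Σ ℕ λ a → Sat φ (a ∷ₑ ρ)

-- environment assigning the listed values to variables 0,1,2,…
-- (remaining variables get 0; they do not matter for formulas whose
-- free variables are among the listed ones)
envL : List ℕ → Env
envL []       i       = 0
envL (x ∷ xs) zero    = x
envL (x ∷ xs) (suc i) = envL xs i

-- m-dimensional interpretation of a linear ordering in (ℕ,+)
-- (formulas without parameters). The domain formula has free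
-- variables 0..m-1; the equivalence and order formulas have free
-- variables 0..2m-1 (first tuple, then second tuple).
-- (D/∼, <*) ≅ (L,<) is expressed by a surjection f : D → L whose
-- kernel is ∼ and which turns <* into <.

record Interpretation (m : ℕ) (L : LinOrd) : Set where
  open LinOrd L
  field
    δ   : Formula
    εq  : Formula
    λt  : Formula
  D : Vec ℕ m → Set
  D x = Sat δ (envL (toList x))
  E : Vec ℕ m → Vec ℕ m → Set
  E x y = Sat εq (envL (toList (x ++ y)))
  Lt : Vec ℕ m → Vec ℕ m → Set
  Lt x y = Sat λt (envL (toList (x ++ y)))
  field
    E-refl  : ∀ x → D x → E x x
    E-sym   : ∀ x y → D x → D y → E x y → E y x
    E-trans : ∀ x y z → D x → D y → D z → E x y → E y z → E x z
    Lt-compat : ∀ x x′ y y′ → D x → D x′ → D y → D y′ →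
                E x x′ → E y y′ → Lt x y → Lt x′ y′
    f       : (x : Vec ℕ m) → D x → Carrier
    f-surj  : ∀ (l : Carrier) → Σ (Vec ℕ m) λ x → Σ (D x) λ dx → f x dx ≡ l
    f-ker₁  : ∀ x y (dx : D x) (dy : D y) → E x y → f x dx ≡ f y dy
    f-ker₂  : ∀ x y (dx : D x) (dy : D y) → f x dx ≡ f y dy → E x y
    f-ord₁  : ∀ x y (dx : D x) (dy : D y) → Lt x y → f x dx <ₗ f y dy
    f-ord₂  : ∀ x y (dx : D x) (dy : D y) → f x dx <ₗ f y dy → Lt x y

Interpretable : LinOrd → Set
Interpretable L = Σ ℕ λ m → 1 ≤ m × Interpretation m L

-- Finiteness of a quotient of a subset: {x | P x}/R is finite iff
-- finitely many elements of P meet every R-class of P.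

FiniteQuot : {A : Set} → (A → Set) → (A → A → Set) → Set
FiniteQuot {A} P R =
  Σ (List A) λ rs → All P rs × (∀ x → P x → Any (λ r → R x r) rs)

FiniteSub : {A : Set} → (A → Set) → Set
FiniteSub P = FiniteQuot P _≡_

module _ (L : LinOrd) where
  open LinOrd L

  Between : Carrier → Carrier → Carrier → Set
  Between a b c = (a <ₗ c × c <ₗ b) ⊎ (b <ₗ c × c <ₗ a)

  -- the relations ≃_n for finite n (only finite levels are needed here)
  VDsim : ℕ → Carrier → Carrier → Set
  VDsim zero    a b = a ≡ b
  VDsim (suc n) a b = FiniteQuot (Between a b) (VDsim n)

  HasVDRank : ℕ → Set
  HasVDRank n = FiniteQuot (λ _ → ⊤) (VDsim n)
              × (∀ k → k < n → ¬ FiniteQuot (λ _ → ⊤) (VDsim k))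

  DenseSub : (Carrier → Set) → Set
  DenseSub S = ∀ a b → S a → S b → a <ₗ b →
               Σ Carrier λ c → S c × a <ₗ c × c <ₗ b

  Scattered : Set₁
  Scattered = ¬ Σ (Carrier → Set) λ S → DenseSub S × ¬ FiniteSub S

-- A class of the relation ≃₁ is convex and any two of its points are finitely many
-- successor steps apart, so it is the union of the chain upwards from a representative
-- and the chain downwards from it.  VD*-rank 1 means there are finitely many classes,
-- so L is the disjoint union of K chains; coding the q-th point of chain a by a + q·K,
-- the domain (residues mod K, lengths of the finite chains) and the order (position
-- within a chain, a fixed table between chains) are definable in (ℕ, +).
--
-- For s : ℕ → Bool let Lₛ = ∑ᵢ (ω + Fᵢ + ω*) with Fᵢ of size i + 1 if s i and empty
-- otherwise.  Lₛ is scattered of rank 2, and s can be read off its isomorphism type: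
-- s n holds iff Lₛ has a maximal finite successor chain of n + 1 points.  Formulas
-- determine the interpreted order up to isomorphism and can be Gödel-numbered, so
-- choosing s n to refute "the formulas numbered n interpret some Lₜ with t n" makes
-- Lₛ non-interpretable.  Excluded middle decides successors, chain lengths and s.
module Submission where

open import Defs
open import Level using (0ℓ; Lift; lift; lower)
open import Axiom.ExcludedMiddle using (ExcludedMiddle)
open import Data.Nat using (ℕ; zero; suc; _<_; _≤_; z≤n; s≤s; _+_; _*_; _∸_)
import Data.Nat.Properties as ℕ
open import Data.Nat.Tactic.RingSolver using (solve-∀)
open import Data.Nat.ListAction using (sum)
open import Data.Nat.Binary using (ℕᵇ; 2[1+_]; 1+[2_]) renaming (zero to zeroᵇ; toℕ to toℕᵇ)
open import Data.Nat.Binary.Properties using () renaming (toℕ-injective to toℕᵇ-injective)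
open import Data.Bool using (Bool; true; false; not; if_then_else_)
open import Data.Fin using (Fin; zero; suc; toℕ; fromℕ<; splitAt; join)
import Data.Fin as Fin
open import Data.Fin.Properties using (toℕ-injective; toℕ<n; toℕ-fromℕ<; join-splitAt; splitAt-join)
open import Data.List using (List; []; _∷_; [_]; _++_; map; filter; length; lookup; allFin; deduplicate)
open import Data.List.Membership.Propositional using (_∈_)
open import Data.List.Membership.Propositional.Properties using (∈-allFin; ∈-lookup)
open import Data.List.Relation.Unary.All using (All; []; _∷_)
import Data.List.Relation.Unary.All as All
open import Data.List.Relation.Unary.All.Properties using (all-filter; ++⁺)
open import Data.List.Relation.Unary.Any using (Any; here; there)
import Data.List.Relation.Unary.Any as Any
import Data.List.Relation.Unary.Any.Properties as Any
open import Data.List.Relation.Unary.AllPairs using (_∷_)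
open import Data.List.Relation.Unary.Unique.DecSetoid.Properties using (deduplicate-!)
import Data.List.Relation.Unary.Unique.Setoid as Unique
open import Data.Maybe using (Maybe; just; nothing; zipWith; _>>=_)
import Data.Maybe as Maybe
open import Data.Maybe.Properties using (just-injective)
open import Data.Vec using (Vec; []; _∷_)
import Data.Vec as Vec
open import Data.Product using (Σ; ∃; ∃₂; _×_; _,_; proj₁; proj₂)
open import Data.Product.Properties using (,-injectiveˡ; ,-injectiveʳ)
open import Data.Sum using (_⊎_; inj₁; inj₂; [_,_]′)
open import Data.Empty using (⊥; ⊥-elim)
open import Data.Unit using (⊤; tt)
open import Function using (_∘_; id; flip; _⇔_; mk⇔; Equivalence)
open import Relation.Nullary using (¬_; Dec; yes; no; does)
open import Relation.Nullary.Decidable using (map′; _×-dec_; _⊎-dec_)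
open import Relation.Unary using (Decidable)
open import Relation.Binary.Bundles using (Setoid; DecSetoid)
open import Relation.Binary.Structures using (IsStrictTotalOrder)
open import Relation.Binary.Definitions using (Tri; tri<; tri≈; tri>)
open import Relation.Binary.PropositionalEquality
  using (_≡_; _≢_; refl; sym; trans; subst; subst₂; cong; cong₂; isEquivalence; module ≡-Reasoning)
import Relation.Binary.Construct.Flip.EqAndOrd as Flip

open Equivalence using (to; from)

decide : ExcludedMiddle (Level.suc 0ℓ) → (X : Set) → Dec X
decide em X = map′ lower lift (em {Lift (Level.suc 0ℓ) X})

Any-≤-sum : ∀ {A : Set} {P : A → Set} (f : A → ℕ) {xs : List A} →
            Any P xs → ∃ λ x → P x × f x ≤ sum (map f xs)
Any-≤-sum f {x ∷ _}  (here px)  = x , px , ℕ.m≤m+n (f x) _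
Any-≤-sum f {x ∷ xs} (there p) with Any-≤-sum f p
... | y , py , fy≤ = y , py , ℕ.≤-trans fy≤ (ℕ.m≤n+m _ (f x))

digit+<digit : ∀ K {i j p} → i < j → p < K → p + i * K < j * K
digit+<digit K {i} {j} {p} i<j p<K = ℕ.≤-trans (ℕ.+-monoˡ-≤ (i * K) p<K) (ℕ.*-monoˡ-≤ K i<j)

digits-unique : ∀ K {i j p q} → p < K → q < K → p + i * K ≡ q + j * K → i ≡ j × p ≡ q
digits-unique K {i} {j} {p} {q} p<K q<K eq with ℕ.<-cmp i j
... | tri< i<j _ _ = ⊥-elim (ℕ.<-irrefl eq (ℕ.≤-trans (digit+<digit K i<j p<K) (ℕ.m≤n+m (j * K) q)))
... | tri> _ _ j<i = ⊥-elim (ℕ.<-irrefl (sym eq) (ℕ.≤-trans (digit+<digit K j<i q<K) (ℕ.m≤n+m (i * K) p)))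
... | tri≈ _ refl _ = refl , ℕ.+-cancelʳ-≡ (i * K) p q eq

finiteQuot-filter : ∀ {A : Set} {P : A → Set} {R : A → A → Set} → Decidable P →
  (cs : List A) → (∀ x → P x → Any (λ r → P r × R x r) cs) → FiniteQuot P R
finiteQuot-filter {P = P} P? cs cover =
  filter P? cs , all-filter P? cs , λ x px → Any.map proj₂ (keep (cover x px))
  where
  keep : ∀ {Q : _ → Set} → Any (λ r → P r × Q r) cs → Any (λ r → P r × Q r) (filter P? cs)
  keep p = [ id , (λ ¬P → ⊥-elim (¬P (proj₁ (Any.lookup-result p)))) ]′ (Any.filter⁺ P? p)

-- Linear orders and the relations ≃ₙ

dual : LinOrd → LinOrd
dual L = record
  { Carrier = LinOrd.Carrier L
  ; _<ₗ_    = flip (LinOrd._<ₗ_ L)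
  ; isSTO   = Flip.isStrictTotalOrder (LinOrd.isSTO L) }

module LinearOrder (L : LinOrd) where
  open LinOrd L public
  open IsStrictTotalOrder isSTO public using (compare; _<?_) renaming (trans to <-trans; asym to <-asym)
  open IsStrictTotalOrder isSTO using (irrefl)

  infix 4 _⋖_ _≃[_]_

  <-irrefl : ∀ {a} → a <ₗ a → ⊥
  <-irrefl = irrefl refl

  _⋖_ : Carrier → Carrier → Set
  a ⋖ b = a <ₗ b × (∀ c → a <ₗ c → c <ₗ b → ⊥)

  ⋖-unique : ∀ {a b c} → a ⋖ b → a ⋖ c → b ≡ c
  ⋖-unique {b = b} {c} (ab , b-next) (ac , c-next) with compare b c
  ... | tri< b<c _ _ = ⊥-elim (c-next b ab b<c)
  ... | tri≈ _ b≡c _ = b≡c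
  ... | tri> _ _ c<b = ⊥-elim (b-next c ac c<b)

  between-sym : ∀ {a b c} → Between L a b c → Between L b a c
  between-sym (inj₁ p) = inj₂ p
  between-sym (inj₂ p) = inj₁ p

  between? : ∀ a b → Decidable (Between L a b)
  between? a b c = ((a <? c) ×-dec (c <? b)) ⊎-dec ((b <? c) ×-dec (c <? a))

  between-split : ∀ {a b c x} → Between L a c x → Between L a b x ⊎ (x ≡ b ⊎ Between L b c x)
  between-split {b = b} {x = x} (inj₁ (a<x , x<c)) with compare x b
  ... | tri< x<b _ _ = inj₁ (inj₁ (a<x , x<b))
  ... | tri≈ _ x≡b _ = inj₂ (inj₁ x≡b)
  ... | tri> _ _ b<x = inj₂ (inj₂ (inj₁ (b<x , x<c)))
  between-split {b = b} {x = x} (inj₂ (c<x , x<a)) with compare x b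
  ... | tri< x<b _ _ = inj₂ (inj₂ (inj₂ (c<x , x<b)))
  ... | tri≈ _ x≡b _ = inj₂ (inj₁ x≡b)
  ... | tri> _ _ b<x = inj₁ (inj₂ (b<x , x<a))

  _≃[_]_ : Carrier → ℕ → Carrier → Set
  a ≃[ n ] b = VDsim L n a b

  ≃-refl : ∀ n {a} → a ≃[ n ] a
  ≃-refl zero    = refl
  ≃-refl (suc n) = [] , [] , λ
    { _ (inj₁ (p , q)) → ⊥-elim (<-asym p q)
    ; _ (inj₂ (p , q)) → ⊥-elim (<-asym p q) }

  ≃-sym : ∀ n {a b} → a ≃[ n ] b → b ≃[ n ] a
  ≃-sym zero    a≡b               = sym a≡b
  ≃-sym (suc n) (cs , inside , cover) =
    cs , All.map between-sym inside , λ x p → cover x (between-sym p)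

  ≃-mono : ∀ n {a b} → a ≃[ n ] b → a ≃[ suc n ] b
  ≃-mono zero    refl                = ≃-refl 1
  ≃-mono (suc n) (cs , inside , cover) = cs , inside , λ x p → Any.map (≃-mono n) (cover x p)

  ⋖⇒≃ : ∀ n {a b} → a ⋖ b → a ≃[ suc n ] b
  ⋖⇒≃ n (a<b , nothing-between) = [] , [] , λ
    { x (inj₁ (p , q)) → ⊥-elim (nothing-between x p q)
    ; x (inj₂ (p , q)) → ⊥-elim (<-asym a<b (<-trans p q)) }

  ≃-trans-< : ∀ n {a b c} → a <ₗ b → b <ₗ c → a ≃[ suc n ] b → b ≃[ suc n ] c → a ≃[ suc n ] c
  ≃-trans-< n {a} {b} {c} a<b b<c (as , a-in , a-cover) (bs , b-in , b-cover) =
    as ++ b ∷ bs , ++⁺ (All.map widenˡ a-in) (inj₁ (a<b , b<c) ∷ All.map widenʳ b-in) , cover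
    where
    widenˡ : ∀ {r} → Between L a b r → Between L a c r
    widenˡ (inj₁ (p , q)) = inj₁ (p , <-trans q b<c)
    widenˡ (inj₂ (p , q)) = ⊥-elim (<-asym a<b (<-trans p q))
    widenʳ : ∀ {r} → Between L b c r → Between L a c r
    widenʳ (inj₁ (p , q)) = inj₁ (<-trans a<b p , q)
    widenʳ (inj₂ (p , q)) = ⊥-elim (<-asym b<c (<-trans p q))
    cover : ∀ x → Between L a c x → Any (λ r → x ≃[ n ] r) (as ++ b ∷ bs)
    cover x p with between-split {b = b} p
    ... | inj₁ q          = Any.++⁺ˡ (a-cover x q)
    ... | inj₂ (inj₁ refl) = Any.++⁺ʳ as (here (≃-refl n))
    ... | inj₂ (inj₂ q)    = Any.++⁺ʳ as (there (b-cover x q))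

  ≃₁-trans : ∀ {a b c} → a ≃[ 1 ] b → b ≃[ 1 ] c → a ≃[ 1 ] c
  ≃₁-trans {a} {b} {c} (as , _ , a-cover) (bs , _ , b-cover) =
    finiteQuot-filter (between? a c) (as ++ b ∷ bs) cover
    where
    cover : ∀ x → Between L a c x → Any (λ r → Between L a c r × x ≡ r) (as ++ b ∷ bs)
    cover x p with between-split {b = b} p
    ... | inj₁ q           = Any.++⁺ˡ (Any.map (λ { refl → p , refl }) (a-cover x q))
    ... | inj₂ (inj₁ refl) = Any.++⁺ʳ as (here (p , refl))
    ... | inj₂ (inj₂ q)    = Any.++⁺ʳ as (there (Any.map (λ { refl → p , refl }) (b-cover x q)))

  ≃₁-convex : ∀ {a b c} → a ≃[ 1 ] b → a <ₗ c → c <ₗ b → a ≃[ 1 ] c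
  ≃₁-convex {a} {b} {c} (cs , _ , cover) a<c c<b = finiteQuot-filter (between? a c) cs cover′
    where
    cover′ : ∀ d → Between L a c d → Any (λ r → Between L a c r × d ≡ r) cs
    cover′ d (inj₁ (p , q)) = Any.map (λ { refl → inj₁ (p , q) , refl }) (cover d (inj₁ (p , <-trans q c<b)))
    cover′ d (inj₂ (p , q)) = ⊥-elim (<-asym a<c (<-trans p q))

  ≃₁-classes-ordered : ∀ {x y r r′} → x ≃[ 1 ] r → y ≃[ 1 ] r′ →
                       r <ₗ r′ → ¬ r ≃[ 1 ] r′ → x <ₗ y
  ≃₁-classes-ordered {x} {y} {r} {r′} x≃r y≃r′ r<r′ r≄r′ with compare x y
  ... | tri< x<y _ _ = x<y
  ... | tri≈ _ refl _ = ⊥-elim (r≄r′ (≃₁-trans (≃-sym 1 x≃r) y≃r′))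
  ... | tri> _ _ y<x with compare x r′
  ...   | tri< x<r′ _ _ = ⊥-elim (r≄r′ (≃₁-trans (≃-sym 1 x≃r)
                            (≃₁-trans (≃-sym 1 (≃₁-convex y≃r′ y<x x<r′)) y≃r′)))
  ...   | tri≈ _ refl _ = ⊥-elim (r≄r′ (≃-sym 1 x≃r))
  ...   | tri> _ _ r′<x = ⊥-elim (r≄r′ (≃₁-convex (≃-sym 1 x≃r) r<r′ r′<x))

≃-dual : ∀ (L : LinOrd) n {a b} → VDsim (dual L) n a b → VDsim L n a b
≃-dual L zero    a≡b                = a≡b
≃-dual L (suc n) (cs , inside , cover) =
  cs , All.map swap inside , λ x p → Any.map (≃-dual L n) (cover x (swap p))
  where
  swap : ∀ {A B C D : Set} → (A × B) ⊎ (C × D) → (D × C) ⊎ (B × A)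
  swap (inj₁ (p , q)) = inj₂ (q , p)
  swap (inj₂ (p , q)) = inj₁ (q , p)

module Components (L : LinOrd) where
  open LinearOrder L

  NoPred NoSucc : Carrier → Set
  NoPred x = ∀ y → ¬ y ⋖ x
  NoSucc x = ∀ y → ¬ x ⋖ y

  EndsAfter : ℕ → Carrier → Set
  EndsAfter zero    x = NoSucc x
  EndsAfter (suc n) x = ∃ λ y → x ⋖ y × EndsAfter n y

  -- a maximal ⋖-chain with exactly n + 1 elements
  HasFiniteComponent : ℕ → Set
  HasFiniteComponent n = ∃ λ x → NoPred x × EndsAfter n x

open Components using (HasFiniteComponent)

record _≅_ (L₁ L₂ : LinOrd) : Set where
  private
    module L₁ = LinOrd L₁
    module L₂ = LinOrd L₂
  field
    to         : L₁.Carrier → L₂.Carrier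
    mono       : ∀ {a b} → a L₁.<ₗ b → to a L₂.<ₗ to b
    surjective : ∀ y → ∃ λ x → to x ≡ y

module _ {L₁ L₂ : LinOrd} (iso : L₁ ≅ L₂) where
  private
    module A = LinearOrder L₁
    module B = LinearOrder L₂
    module CA = Components L₁
    module CB = Components L₂
  open _≅_ iso renaming (to to h)

  reflect : ∀ {a b} → h a B.<ₗ h b → a A.<ₗ b
  reflect {a} {b} p with A.compare a b
  ... | tri< a<b _ _ = a<b
  ... | tri≈ _ refl _ = ⊥-elim (B.<-irrefl p)
  ... | tri> _ _ b<a = ⊥-elim (B.<-asym p (mono b<a))

  ⋖-preserved : ∀ {a b} → a A.⋖ b → h a B.⋖ h b
  ⋖-preserved (a<b , nothing-between) = mono a<b , λ z p q →
    let (w , w↦z) = surjective z in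
    nothing-between w (reflect (subst (h _ B.<ₗ_) (sym w↦z) p))
                      (reflect (subst (B._<ₗ h _) (sym w↦z) q))

  ⋖-reflected : ∀ {a b} → h a B.⋖ h b → a A.⋖ b
  ⋖-reflected (a<b , nothing-between) = reflect a<b , λ z p q → nothing-between (h z) (mono p) (mono q)

  NoPred-preserved : ∀ {x} → CA.NoPred x → CB.NoPred (h x)
  NoPred-preserved no-pred y y⋖x with surjective y
  ... | w , refl = no-pred w (⋖-reflected y⋖x)

  NoSucc-preserved : ∀ {x} → CA.NoSucc x → CB.NoSucc (h x)
  NoSucc-preserved no-succ y x⋖y with surjective y
  ... | w , refl = no-succ w (⋖-reflected x⋖y)

  EndsAfter-preserved : ∀ n {x} → CA.EndsAfter n x → CB.EndsAfter n (h x)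
  EndsAfter-preserved zero    ends              = NoSucc-preserved ends
  EndsAfter-preserved (suc n) (y , x⋖y , ends) = h y , ⋖-preserved x⋖y , EndsAfter-preserved n ends

  HasFiniteComponent-preserved : ∀ n → HasFiniteComponent L₁ n → HasFiniteComponent L₂ n
  HasFiniteComponent-preserved n (x , no-pred , ends) =
    h x , NoPred-preserved no-pred , EndsAfter-preserved n ends

-- Definability in (ℕ, +)

addTimes : Term → ℕ → Term → Term
addTimes t zero    u = t
addTimes t (suc c) u = addTimes (t ⊕ u) c u

evalT-addTimes : ∀ ρ t c u → evalT ρ (addTimes t c u) ≡ evalT ρ t + c * evalT ρ u
evalT-addTimes ρ t zero    u = sym (ℕ.+-identityʳ _)
evalT-addTimes ρ t (suc c) u = trans (evalT-addTimes ρ (t ⊕ u) c u) (ℕ.+-assoc (evalT ρ t) (evalT ρ u) _)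

⋁ : ∀ K → (Fin K → Formula) → Formula
⋁ zero    F = ff
⋁ (suc K) F = F Fin.zero ∨f ⋁ K (F ∘ Fin.suc)

Sat-⋁ : ∀ K (F : Fin K → Formula) ρ → Sat (⋁ K F) ρ ⇔ ∃ λ a → Sat (F a) ρ
Sat-⋁ K F ρ = mk⇔ (⇒ K F) (⇐ K F)
  where
  ⇒ : ∀ K (F : Fin K → Formula) → Sat (⋁ K F) ρ → ∃ λ a → Sat (F a) ρ
  ⇒ (suc K) F (inj₁ s) = Fin.zero , s
  ⇒ (suc K) F (inj₂ s) = let (a , sa) = ⇒ K (F ∘ Fin.suc) s in Fin.suc a , sa
  ⇐ : ∀ K (F : Fin K → Formula) → (∃ λ a → Sat (F a) ρ) → Sat (⋁ K F) ρ
  ⇐ (suc K) F (Fin.zero  , s) = inj₁ s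
  ⇐ (suc K) F (Fin.suc a , s) = inj₂ (⇐ K (F ∘ Fin.suc) (a , s))

truth : Bool → Formula
truth true  = tt
truth false = ff

Sat-truth : ∀ b ρ → Sat (truth b) ρ ⇔ b ≡ true
Sat-truth true  ρ = mk⇔ (λ _ → refl) (λ _ → tt)
Sat-truth false ρ = mk⇔ ⊥-elim (λ ())

-- There is no constant symbol; variable o is forced to denote 1.
isOne : ℕ → Formula
isOne o = (¬f ((var o ⊕ var o) ≐ var o))
       ∧f (∀f (((var 0 ⊕ var 0) ≐ var 0) ∨f (∃f (var 1 ≐ (var (2 + o) ⊕ var 0)))))

Sat-isOne : ∀ ρ o → Sat (isOne o) ρ ⇔ ρ o ≡ 1
Sat-isOne ρ o = mk⇔ ⇒ ⇐
  where
  ⇒ : Sat (isOne o) ρ → ρ o ≡ 1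
  ⇒ (nonzero , zero-or-succ) with ρ o | zero-or-succ 1
  ... | zero        | _            = ⊥-elim (nonzero refl)
  ... | suc zero    | _            = refl
  ... | suc (suc _) | inj₁ ()
  ... | suc (suc _) | inj₂ (_ , ())
  ⇐ : ρ o ≡ 1 → Sat (isOne o) ρ
  ⇐ o≡1 = (λ o+o≡o → 2≢1 (trans (cong (λ u → u + u) (sym o≡1)) (trans o+o≡o o≡1))) , zero-or-succ
    where
    2≢1 : ¬ 2 ≡ 1
    2≢1 ()
    zero-or-succ : ∀ u → Sat (((var 0 ⊕ var 0) ≐ var 0) ∨f (∃f (var 1 ≐ (var (2 + o) ⊕ var 0)))) (u ∷ₑ ρ)
    zero-or-succ zero    = inj₁ refl
    zero-or-succ (suc u) = inj₂ (u , cong (_+ u) (sym o≡1))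

Sat-∃one : ∀ {φ} {P : Env → Set} → (∀ ρ → Sat φ (1 ∷ₑ ρ) ⇔ P ρ) →
           ∀ ρ → Sat (∃f (isOne 0 ∧f φ)) ρ ⇔ P ρ
Sat-∃one {φ} {P} sem ρ = mk⇔ ⇒ (λ p → 1 , from (Sat-isOne (1 ∷ₑ ρ) 0) refl , from (sem ρ) p)
  where
  ⇒ : Sat (∃f (isOne 0 ∧f φ)) ρ → P ρ
  ⇒ (o , one , s) with to (Sat-isOne (o ∷ₑ ρ) 0) one
  ... | refl = to (sem ρ) s

lessThan : ℕ → ℕ → ℕ → Formula
lessThan x y o = ∃f (((var (suc x) ⊕ var 0) ⊕ var (suc o)) ≐ var (suc y))

Sat-lessThan : ∀ ρ x y o → ρ o ≡ 1 → Sat (lessThan x y o) ρ ⇔ ρ x < ρ y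
Sat-lessThan ρ x y o o≡1 = mk⇔ ⇒ ⇐
  where
  ⇒ : Sat (lessThan x y o) ρ → ρ x < ρ y
  ⇒ (d , eq) = subst (ρ x <_) (trans (cong (ρ x + d +_) (sym o≡1)) eq)
                 (subst (ρ x <_) (sym (ℕ.+-suc (ρ x + d) 0))
                   (s≤s (subst (ρ x ≤_) (sym (ℕ.+-identityʳ _)) (ℕ.m≤m+n (ρ x) d))))
  ⇐ : ρ x < ρ y → Sat (lessThan x y o) ρ
  ⇐ x<y = ρ y ∸ suc (ρ x) , (begin
    ρ x + (ρ y ∸ suc (ρ x)) + ρ o ≡⟨ cong (ρ x + (ρ y ∸ suc (ρ x)) +_) o≡1 ⟩
    ρ x + (ρ y ∸ suc (ρ x)) + 1   ≡⟨ ℕ.+-comm _ 1 ⟩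
    suc (ρ x + (ρ y ∸ suc (ρ x))) ≡⟨ ℕ.m+[n∸m]≡n x<y ⟩
    ρ y                           ∎)
    where open ≡-Reasoning

-- x < c, stated as ¬ ∃d. x = d + c because no term denotes 0
lessThanNumeral : ℕ → ℕ → ℕ → Formula
lessThanNumeral x c o = ¬f (∃f (var (suc x) ≐ addTimes (var 0) c (var (suc o))))

Sat-lessThanNumeral : ∀ ρ x c o → ρ o ≡ 1 → Sat (lessThanNumeral x c o) ρ ⇔ ρ x < c
Sat-lessThanNumeral ρ x c o o≡1 = mk⇔ ⇒ ⇐
  where
  eval : ∀ d → evalT (d ∷ₑ ρ) (addTimes (var 0) c (var (suc o))) ≡ d + c
  eval d = trans (evalT-addTimes (d ∷ₑ ρ) (var 0) c (var (suc o)))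
                 (cong (d +_) (trans (cong (c *_) o≡1) (ℕ.*-identityʳ c)))
  ⇒ : Sat (lessThanNumeral x c o) ρ → ρ x < c
  ⇒ no-d = ℕ.≰⇒> λ c≤x → no-d (ρ x ∸ c , trans (sym (ℕ.m∸n+n≡m c≤x)) (sym (eval (ρ x ∸ c))))
  ⇐ : ρ x < c → Sat (lessThanNumeral x c o) ρ
  ⇐ x<c (d , eq) = ℕ.<⇒≱ x<c (subst (c ≤_) (sym (trans eq (eval d))) (ℕ.m≤n+m c d))

-- x = a + q * K, with q added to both sides because no term denotes 0
hasDigits : ℕ → ℕ → ℕ → ℕ → ℕ → Formula
hasDigits K a x q o = (var x ⊕ var q) ≐ addTimes (addTimes (var q) K (var q)) a (var o)

Sat-hasDigits : ∀ ρ K a x q o → ρ o ≡ 1 → Sat (hasDigits K a x q o) ρ ⇔ ρ x ≡ a + ρ q * K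
Sat-hasDigits ρ K a x q o o≡1 = mk⇔
  (λ eq → ℕ.+-cancelʳ-≡ (ρ q) _ _ (trans eq eval))
  (λ eq → trans (cong (_+ ρ q) eq) (sym eval))
  where
  open ≡-Reasoning
  eval : evalT ρ (addTimes (addTimes (var q) K (var q)) a (var o)) ≡ a + ρ q * K + ρ q
  eval = begin
    evalT ρ (addTimes (addTimes (var q) K (var q)) a (var o)) ≡⟨ evalT-addTimes ρ _ a (var o) ⟩
    evalT ρ (addTimes (var q) K (var q)) + a * ρ o            ≡⟨ cong₂ _+_ (evalT-addTimes ρ (var q) K (var q))
                                                                   (trans (cong (a *_) o≡1) (ℕ.*-identityʳ a)) ⟩
    ρ q + K * ρ q + a                                         ≡⟨ rearrange (ρ q) K a ⟩
    a + ρ q * K + ρ q                                         ∎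
    where
    rearrange : ∀ q k a → q + k * q + a ≡ a + q * k + q
    rearrange = solve-∀

WithinLength : Maybe ℕ → ℕ → Set
WithinLength nothing  q = ⊤
WithinLength (just B) q = q < B

withinLength : Maybe ℕ → ℕ → ℕ → Formula
withinLength nothing  q o = tt
withinLength (just B) q o = lessThanNumeral q B o

Sat-withinLength : ∀ ρ len q o → ρ o ≡ 1 → Sat (withinLength len q o) ρ ⇔ WithinLength len (ρ q)
Sat-withinLength ρ nothing  q o o≡1 = mk⇔ (λ _ → tt) (λ _ → tt)
Sat-withinLength ρ (just B) q o o≡1 = Sat-lessThanNumeral ρ q B o o≡1

downward-closed⇒initial-segment : ∀ {P : ℕ → Set} → (∀ q → Dec (P q)) → (∀ q → P (suc q) → P q) →
  ∀ N → ¬ P N → ∃ λ B → ∀ q → P q ⇔ q < B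
downward-closed⇒initial-segment {P} P? down = go
  where
  down* : ∀ {m q} → P q → m ≤ q → P m
  down* {q = zero}  p z≤n = p
  down* {q = suc q} p m≤q with ℕ.m≤n⇒m<n∨m≡n m≤q
  ... | inj₂ refl = p
  ... | inj₁ m<q  = down* (down q p) (ℕ.≤-pred m<q)
  go : ∀ N → ¬ P N → ∃ λ B → ∀ q → P q ⇔ q < B
  go zero    ¬P0 = 0 , λ q → mk⇔ (λ pq → ⊥-elim (¬P0 (down* pq z≤n))) (λ ())
  go (suc N) ¬PN+1 with P? N
  ... | yes PN = suc N , λ q → mk⇔ (λ pq → ℕ.≰⇒> λ N+1≤q → ¬PN+1 (down* pq N+1≤q))
                                   (λ q<N+1 → down* PN (ℕ.≤-pred q<N+1))
  ... | no ¬PN = go N ¬PN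

downward-closed⇒length : ExcludedMiddle (Level.suc 0ℓ) → ∀ {P : ℕ → Set} → (∀ q → P (suc q) → P q) →
  ∃ λ len → ∀ q → P q ⇔ WithinLength len q
downward-closed⇒length em {P} down with decide em (∃ λ N → ¬ P N)
... | yes (N , ¬PN) = let (B , spec) = downward-closed⇒initial-segment (λ q → decide em (P q)) down N ¬PN
                      in just B , spec
... | no all-P = nothing , λ q → mk⇔ (λ _ → tt) (λ _ → stable q)
  where
  stable : ∀ q → P q
  stable q with decide em (P q)
  ... | yes p  = p
  ... | no ¬p = ⊥-elim (all-P (q , ¬p))

Oriented : Bool → ℕ → ℕ → Set
Oriented true  q q′ = q < q′
Oriented false q q′ = q′ < q

oriented : Bool → ℕ → ℕ → ℕ → Formula
oriented true  q q′ o = lessThan q q′ o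
oriented false q q′ o = lessThan q′ q o

oriented-connex : ∀ b {q q′} → q ≢ q′ → Oriented b q q′ ⊎ Oriented b q′ q
oriented-connex b {q} {q′} q≢q′ with ℕ.<-cmp q q′ | b
... | tri< q<q′ _ _ | true  = inj₁ q<q′
... | tri< q<q′ _ _ | false = inj₂ q<q′
... | tri≈ _ q≡q′ _ | _     = ⊥-elim (q≢q′ q≡q′)
... | tri> _ _ q′<q | true  = inj₂ q′<q
... | tri> _ _ q′<q | false = inj₁ q′<q

Sat-oriented : ∀ ρ b q q′ o → ρ o ≡ 1 → Sat (oriented b q q′ o) ρ ⇔ Oriented b (ρ q) (ρ q′)
Sat-oriented ρ true  q q′ o o≡1 = Sat-lessThan ρ q q′ o o≡1
Sat-oriented ρ false q q′ o o≡1 = Sat-lessThan ρ q′ q o o≡1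

-- Interpreting a finite union of chains

-- L is the disjoint union of K chains: chain a is defined on an initial segment of ℕ and
-- lists its points monotonically (upwards or downwards); distinct chains are ordered as wholes.
record ChainDecomposition (L : LinOrd) (K : ℕ) : Set where
  open LinOrd L
  field
    chain          : Fin K → ℕ → Maybe Carrier
    ascending      : Fin K → Bool
    chain-downward : ∀ a q {e} → chain a (suc q) ≡ just e → ∃ λ d → chain a q ≡ just d
    chain-covers   : ∀ e → ∃₂ λ a q → chain a q ≡ just e
    chain-disjoint : ∀ {a a′ q q′ e} → chain a q ≡ just e → chain a′ q′ ≡ just e → a ≡ a′
    chain-strict   : ∀ {a q q′ e e′} → chain a q ≡ just e → chain a q′ ≡ just e′ →
                     Oriented (ascending a) q q′ → e <ₗ e′
    chain-uniform  : ∀ {a a′ q q′ p p′ e e′ d d′} → a ≢ a′ →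
                     chain a q ≡ just e → chain a′ q′ ≡ just e′ → e <ₗ e′ →
                     chain a p ≡ just d → chain a′ p′ ≡ just d′ → d <ₗ d′

module ChainInterpretation (em : ExcludedMiddle (Level.suc 0ℓ)) {L : LinOrd} {K : ℕ}
                           (C : ChainDecomposition L K) where
  open LinearOrder L
  open ChainDecomposition C

  code : Fin K → ℕ → ℕ
  code a q = toℕ a + q * K

  code-injective : ∀ {a a′ q q′} → code a q ≡ code a′ q′ → a ≡ a′ × q ≡ q′
  code-injective {a} {a′} eq with digits-unique K (toℕ<n a) (toℕ<n a′) eq
  ... | q≡q′ , a≡a′ = toℕ-injective a≡a′ , q≡q′

  chain-reflects : ∀ {a q q′ e e′} → chain a q ≡ just e → chain a q′ ≡ just e′ →
                   e <ₗ e′ → Oriented (ascending a) q q′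
  chain-reflects {a} {q} {q′} ↦e ↦e′ e<e′ with q ℕ.≟ q′
  ... | yes refl = ⊥-elim (<-irrefl (subst (_ <ₗ_) (just-injective (trans (sym ↦e′) ↦e)) e<e′))
  ... | no q≢q′ with oriented-connex (ascending a) q≢q′
  ...   | inj₁ q↗q′ = q↗q′
  ...   | inj₂ q′↗q = ⊥-elim (<-asym e<e′ (chain-strict ↦e′ ↦e q′↗q))

  chain-injective : ∀ {a q q′ e} → chain a q ≡ just e → chain a q′ ≡ just e → q ≡ q′
  chain-injective {a} {q} {q′} ↦e ↦e′ with q ℕ.≟ q′
  ... | yes q≡q′ = q≡q′
  ... | no  q≢q′ = ⊥-elim (<-irrefl ([ chain-strict ↦e ↦e′ , chain-strict ↦e′ ↦e ]′
                                        (oriented-connex (ascending a) q≢q′)))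

  Defined : Fin K → ℕ → Set
  Defined a q = ∃ λ e → chain a q ≡ just e

  chain-length : ∀ a → ∃ λ len → ∀ q → Defined a q ⇔ WithinLength len q
  chain-length a = downward-closed⇒length em (λ q (_ , ↦e) → chain-downward a q ↦e)

  chainLength : Fin K → Maybe ℕ
  chainLength a = proj₁ (chain-length a)

  chainLength-spec : ∀ a q → Defined a q ⇔ WithinLength (chainLength a) q
  chainLength-spec a = proj₂ (chain-length a)

  ChainBelow : Fin K → Fin K → Set
  ChainBelow a a′ = ∃₂ λ q q′ → ∃₂ λ e e′ →
                    chain a q ≡ just e × chain a′ q′ ≡ just e′ × e <ₗ e′

  below : Fin K → Fin K → Bool
  below a a′ = does (decide em (ChainBelow a a′))

  below-spec : ∀ {a a′ q q′ e e′} → a ≢ a′ → chain a q ≡ just e → chain a′ q′ ≡ just e′ →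
               e <ₗ e′ ⇔ below a a′ ≡ true
  below-spec {a} {a′} {q} {q′} {e} {e′} a≢a′ ↦e ↦e′ = spec (decide em (ChainBelow a a′))
    where
    spec : (d : Dec (ChainBelow a a′)) → e <ₗ e′ ⇔ does d ≡ true
    spec (yes (_ , _ , _ , _ , ↦d , ↦d′ , d<d′)) =
      mk⇔ (λ _ → refl) (λ _ → chain-uniform a≢a′ ↦d ↦d′ d<d′ ↦e ↦e′)
    spec (no ¬below) = mk⇔ (λ e<e′ → ⊥-elim (¬below (q , q′ , e , e′ , ↦e , ↦e′ , e<e′))) (λ ())

  ChainOrder : ∀ {a a′} → Dec (a ≡ a′) → ℕ → ℕ → Set
  ChainOrder {a}      (yes _) q q′ = Oriented (ascending a) q q′
  ChainOrder {a} {a′} (no _)  q q′ = below a a′ ≡ true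

  chainOrder : ∀ {a a′} → Dec (a ≡ a′) → ℕ → ℕ → ℕ → Formula
  chainOrder {a}      (yes _) q q′ o = oriented (ascending a) q q′ o
  chainOrder {a} {a′} (no _)  q q′ o = truth (below a a′)

  Sat-chainOrder : ∀ ρ {a a′} (a≟a′ : Dec (a ≡ a′)) q q′ o → ρ o ≡ 1 →
                   Sat (chainOrder a≟a′ q q′ o) ρ ⇔ ChainOrder a≟a′ (ρ q) (ρ q′)
  Sat-chainOrder ρ {a}      (yes _) q q′ o o≡1 = Sat-oriented ρ (ascending a) q q′ o o≡1
  Sat-chainOrder ρ {a} {a′} (no _)  q q′ o o≡1 = Sat-truth (below a a′) ρ

  InDomain : ℕ → Set
  InDomain x = ∃₂ λ a q → x ≡ code a q × WithinLength (chainLength a) q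

  -- environment inside the quantifiers ∃o ∃q: q = 0, o = 1, x = 2
  inChain : Fin K → Formula
  inChain a = ∃f (hasDigits K (toℕ a) 2 0 1 ∧f withinLength (chainLength a) 0 1)

  domainFormula : Formula
  domainFormula = ∃f (isOne 0 ∧f ⋁ K inChain)

  Sat-domainFormula : ∀ ρ → Sat domainFormula ρ ⇔ InDomain (ρ 0)
  Sat-domainFormula = Sat-∃one λ ρ → mk⇔
    (λ s → let (a , q , digits , within) = to (Sat-⋁ K inChain (1 ∷ₑ ρ)) s
           in a , q , to (Sat-hasDigits (q ∷ₑ (1 ∷ₑ ρ)) K (toℕ a) 2 0 1 refl) digits ,
                      to (Sat-withinLength (q ∷ₑ (1 ∷ₑ ρ)) (chainLength a) 0 1 refl) within)
    (λ (a , q , x≡ , within) → from (Sat-⋁ K inChain (1 ∷ₑ ρ))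
             (a , q , from (Sat-hasDigits (q ∷ₑ (1 ∷ₑ ρ)) K (toℕ a) 2 0 1 refl) x≡ ,
                      from (Sat-withinLength (q ∷ₑ (1 ∷ₑ ρ)) (chainLength a) 0 1 refl) within))

  Ordered : ℕ → ℕ → Set
  Ordered x y = ∃₂ λ a a′ → ∃₂ λ q q′ →
                x ≡ code a q × y ≡ code a′ q′ × ChainOrder (a Fin.≟ a′) q q′

  -- environment inside the quantifiers ∃o ∃q ∃q′: q′ = 0, q = 1, o = 2, x = 3, y = 4
  inChains : Fin K → Fin K → Formula
  inChains a a′ = ∃f (∃f (hasDigits K (toℕ a) 3 1 2 ∧f
                          (hasDigits K (toℕ a′) 4 0 2 ∧f chainOrder (a Fin.≟ a′) 1 0 2)))

  orderFormula : Formula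
  orderFormula = ∃f (isOne 0 ∧f ⋁ K (λ a → ⋁ K (inChains a)))

  Sat-orderFormula : ∀ ρ → Sat orderFormula ρ ⇔ Ordered (ρ 0) (ρ 1)
  Sat-orderFormula = Sat-∃one λ ρ → mk⇔
    (λ s → let (a , s′)                        = to (Sat-⋁ K (λ a → ⋁ K (inChains a)) (1 ∷ₑ ρ)) s
               (a′ , q , q′ , dx , dy , ord) = to (Sat-⋁ K (inChains a) (1 ∷ₑ ρ)) s′
               σ = q′ ∷ₑ (q ∷ₑ (1 ∷ₑ ρ))
           in a , a′ , q , q′ ,
              to (Sat-hasDigits σ K (toℕ a) 3 1 2 refl) dx ,
              to (Sat-hasDigits σ K (toℕ a′) 4 0 2 refl) dy ,
              to (Sat-chainOrder σ (a Fin.≟ a′) 1 0 2 refl) ord)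
    (λ (a , a′ , q , q′ , x≡ , y≡ , ord) →
       let σ = q′ ∷ₑ (q ∷ₑ (1 ∷ₑ ρ)) in
       from (Sat-⋁ K (λ a → ⋁ K (inChains a)) (1 ∷ₑ ρ)) (a ,
       from (Sat-⋁ K (inChains a) (1 ∷ₑ ρ)) (a′ , q , q′ ,
         from (Sat-hasDigits σ K (toℕ a) 3 1 2 refl) x≡ ,
         from (Sat-hasDigits σ K (toℕ a′) 4 0 2 refl) y≡ ,
         from (Sat-chainOrder σ (a Fin.≟ a′) 1 0 2 refl) ord)))

  Represents : ℕ → Carrier → Set
  Represents x e = ∃₂ λ a q → x ≡ code a q × chain a q ≡ just e

  element : ∀ x → InDomain x → Carrier
  element x (a , q , _ , within) = proj₁ (from (chainLength-spec a q) within)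

  element-represents : ∀ x dx → Represents x (element x dx)
  element-represents x (a , q , x≡ , within) = a , q , x≡ , proj₂ (from (chainLength-spec a q) within)

  represents-inDomain : ∀ {x e} → Represents x e → InDomain x
  represents-inDomain {e = e} (a , q , x≡ , ↦e) = a , q , x≡ , to (chainLength-spec a q) (e , ↦e)

  represents-at : ∀ {x e a q} → Represents x e → x ≡ code a q → chain a q ≡ just e
  represents-at {a = a′} {q′} (a , q , x≡ , ↦e) x≡′
    with code-injective {a} {a′} {q} {q′} (trans (sym x≡) x≡′)
  ... | refl , refl = ↦e

  represents-functional : ∀ {x e e′} → Represents x e → Represents x e′ → e ≡ e′
  represents-functional r (a , q , x≡ , ↦e′) = just-injective (trans (sym (represents-at r x≡)) ↦e′)

  represents-injective : ∀ {x y e} → Represents x e → Represents y e → x ≡ y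
  represents-injective (a , q , x≡ , ↦e) (a′ , q′ , y≡ , ↦e′) with chain-disjoint ↦e ↦e′
  ... | refl with chain-injective ↦e ↦e′
  ...   | refl = trans x≡ (sym y≡)

  ordered⇒< : ∀ {x y e e′} → Represents x e → Represents y e′ → Ordered x y → e <ₗ e′
  ordered⇒< {e = e} {e′} rx ry (a , a′ , q , q′ , x≡ , y≡ , ord) =
    by (a Fin.≟ a′) ord (represents-at rx x≡) (represents-at ry y≡)
    where
    by : ∀ {a′} (a≟a′ : Dec (a ≡ a′)) → ChainOrder a≟a′ q q′ →
         chain a q ≡ just e → chain a′ q′ ≡ just e′ → e <ₗ e′
    by (yes refl) ord ↦e ↦e′ = chain-strict ↦e ↦e′ ord
    by (no a≢a′)  ord ↦e ↦e′ = from (below-spec a≢a′ ↦e ↦e′) ord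

  <⇒ordered : ∀ {x y e e′} → Represents x e → Represents y e′ → e <ₗ e′ → Ordered x y
  <⇒ordered {e = e} {e′} (a , q , x≡ , ↦e) (a′ , q′ , y≡ , ↦e′) e<e′ =
    a , a′ , q , q′ , x≡ , y≡ , by (a Fin.≟ a′) ↦e′
    where
    by : ∀ {a′} (a≟a′ : Dec (a ≡ a′)) → chain a′ q′ ≡ just e′ → ChainOrder a≟a′ q q′
    by (yes refl) ↦e′ = chain-reflects ↦e ↦e′ e<e′
    by (no a≢a′)  ↦e′ = to (below-spec a≢a′ ↦e ↦e′) e<e′

  interpretation : Interpretation 1 L
  interpretation = record
    { δ         = domainFormula
    ; εq        = var 0 ≐ var 1
    ; λt        = orderFormula
    ; E-refl    = λ { (_ ∷ []) _ → refl }
    ; E-sym     = λ { (_ ∷ []) (_ ∷ []) _ _ → sym }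
    ; E-trans   = λ { (_ ∷ []) (_ ∷ []) (_ ∷ []) _ _ _ → trans }
    ; Lt-compat = λ { (_ ∷ []) (_ ∷ []) (_ ∷ []) (_ ∷ []) _ _ _ _ refl refl s → s }
    ; f         = f
    ; f-surj    = surj
    ; f-ker₁    = λ { (n ∷ []) (_ ∷ []) dx dy refl → represents-functional (f-represents n dx) (f-represents n dy) }
    ; f-ker₂    = λ { (n ∷ []) (m ∷ []) dx dy fx≡fy →
                        represents-injective (f-represents n dx) (subst (Represents m) (sym fx≡fy) (f-represents m dy)) }
    ; f-ord₁    = λ { (n ∷ []) (m ∷ []) dx dy s →
                        ordered⇒< (f-represents n dx) (f-represents m dy) (to (Sat-orderFormula _) s) }
    ; f-ord₂    = λ { (n ∷ []) (m ∷ []) dx dy e<e′ →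
                        from (Sat-orderFormula _) (<⇒ordered (f-represents n dx) (f-represents m dy) e<e′) }
    }
    where
    D₁ : Vec ℕ 1 → Set
    D₁ x = Sat domainFormula (envL (Vec.toList x))
    f : ∀ x → D₁ x → Carrier
    f (n ∷ []) d = element n (to (Sat-domainFormula _) d)
    f-represents : ∀ n (d : D₁ (n ∷ [])) → Represents n (f (n ∷ []) d)
    f-represents n d = element-represents n (to (Sat-domainFormula _) d)
    surj : ∀ e → ∃ λ x → Σ (D₁ x) λ dx → f x dx ≡ e
    surj e with chain-covers e
    ... | a , q , ↦e = code a q ∷ [] , d , represents-functional (f-represents (code a q) d) (a , q , refl , ↦e)
      where
      d : D₁ (code a q ∷ [])
      d = from (Sat-domainFormula _) (represents-inDomain (a , q , refl , ↦e))

-- Orders of rank 1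

module Successors (em : ExcludedMiddle (Level.suc 0ℓ)) (L : LinOrd) where
  open LinearOrder L

  successorFrom : ∀ {x} → Dec (∃ (x ⋖_)) → Maybe Carrier
  successorFrom (yes (y , _)) = just y
  successorFrom (no _)        = nothing

  next : Carrier → Maybe Carrier
  next x = successorFrom (decide em (∃ (x ⋖_)))

  next-⋖ : ∀ {x y} → next x ≡ just y → x ⋖ y
  next-⋖ {x} = by (decide em (∃ (x ⋖_)))
    where
    by : ∀ {y} (d : Dec (∃ (x ⋖_))) → successorFrom d ≡ just y → x ⋖ y
    by (yes (_ , x⋖y)) refl = x⋖y
    by (no _)          ()

  ⋖-next : ∀ {x y} → x ⋖ y → next x ≡ just y
  ⋖-next {x} {y} x⋖y = by (decide em (∃ (x ⋖_)))
    where
    by : (d : Dec (∃ (x ⋖_))) → successorFrom d ≡ just y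
    by (yes (_ , x⋖y′)) = cong just (⋖-unique x⋖y′ x⋖y)
    by (no none)        = ⊥-elim (none (y , x⋖y))

  iterate : ℕ → Carrier → Maybe Carrier
  iterate zero    x = just x
  iterate (suc n) x = next x >>= iterate n

  iterate-step : ∀ n {x y} → iterate (suc n) x ≡ just y → ∃ λ x′ → x ⋖ x′ × iterate n x′ ≡ just y
  iterate-step n {x} eq with next x in next≡
  ... | just x′ = x′ , next-⋖ next≡ , eq

  iterate-⋖ : ∀ n {x x′ y} → x ⋖ x′ → iterate n x′ ≡ just y → iterate (suc n) x ≡ just y
  iterate-⋖ n x⋖x′ eq rewrite ⋖-next x⋖x′ = eq

  iterate-≤ : ∀ n {x y} → iterate n x ≡ just y → x ≡ y ⊎ x <ₗ y
  iterate-≤ zero    refl = inj₁ refl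
  iterate-≤ (suc n) eq with iterate-step n eq
  ... | x′ , (x<x′ , _) , eq′ with iterate-≤ n eq′
  ...   | inj₁ refl = inj₂ x<x′
  ...   | inj₂ x′<y = inj₂ (<-trans x<x′ x′<y)

  iterate-< : ∀ n {x y} → iterate (suc n) x ≡ just y → x <ₗ y
  iterate-< n eq with iterate-step n eq
  ... | x′ , (x<x′ , _) , eq′ with iterate-≤ n eq′
  ...   | inj₁ refl = x<x′
  ...   | inj₂ x′<y = <-trans x<x′ x′<y

  iterate-≃₁ : ∀ n {x y} → iterate n x ≡ just y → x ≃[ 1 ] y
  iterate-≃₁ zero    refl = ≃-refl 1
  iterate-≃₁ (suc n) eq with iterate-step n eq
  ... | x′ , x⋖x′ , eq′ = ≃₁-trans (⋖⇒≃ 0 x⋖x′) (iterate-≃₁ n eq′)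

  iterate-strict : ∀ n m {x y z} → iterate n x ≡ just y → iterate m x ≡ just z → n < m → y <ₗ z
  iterate-strict zero    (suc m) refl eq′ _ = iterate-< m eq′
  iterate-strict (suc n) (suc m) eq   eq′ (s≤s n<m) with iterate-step n eq | iterate-step m eq′
  ... | x′ , x⋖x′ , eq₁ | x″ , x⋖x″ , eq₂ with ⋖-unique x⋖x′ x⋖x″
  ...   | refl = iterate-strict n m eq₁ eq₂ n<m

  iterate-downward : ∀ n {x y} → iterate (suc n) x ≡ just y → ∃ λ y′ → iterate n x ≡ just y′
  iterate-downward zero    eq = _ , refl
  iterate-downward (suc n) eq with iterate-step (suc n) eq
  ... | x′ , x⋖x′ , eq′ with iterate-downward n eq′
  ...   | y′ , eq″ = y′ , iterate-⋖ n x⋖x′ eq″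

  iterate-+ : ∀ n m {x y z} → iterate n x ≡ just y → iterate m y ≡ just z → iterate (n + m) x ≡ just z
  iterate-+ zero    m refl eq′ = eq′
  iterate-+ (suc n) m eq   eq′ with iterate-step n eq
  ... | x′ , x⋖x′ , eq₁ = iterate-⋖ (n + m) x⋖x′ (iterate-+ n m eq₁ eq′)

  iterate-reaches′ : ∀ cs {x y} → x <ₗ y → (∀ c → Between L x y c → c ∈ cs) →
                     ∃ λ n → iterate n x ≡ just y
  iterate-reaches′ [] x<y cover =
    1 , iterate-⋖ 0 (x<y , λ c x<c c<y → none (cover c (inj₁ (x<c , c<y)))) refl
    where
    none : ∀ {c} → ¬ c ∈ []
    none ()
  iterate-reaches′ (c ∷ cs) {x} {y} x<y cover with between? x y c
  ... | no c-outside =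
    iterate-reaches′ cs x<y λ d d-inside → drop (cover d d-inside) (λ { refl → c-outside d-inside })
    where
    drop : ∀ {d} → d ∈ c ∷ cs → ¬ d ≡ c → d ∈ cs
    drop (here d≡c) d≢c = ⊥-elim (d≢c d≡c)
    drop (there d∈) _   = d∈
  ... | yes (inj₂ (y<c , c<x)) = ⊥-elim (<-asym x<y (<-trans y<c c<x))
  ... | yes (inj₁ (x<c , c<y)) =
    let (n , x↦c) = iterate-reaches′ cs x<c cover₁
        (m , c↦y) = iterate-reaches′ cs c<y cover₂
    in n + m , iterate-+ n m x↦c c↦y
    where
    cover₁ : ∀ d → Between L x c d → d ∈ cs
    cover₁ d (inj₁ (x<d , d<c)) with cover d (inj₁ (x<d , <-trans d<c c<y))
    ... | here refl = ⊥-elim (<-irrefl d<c)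
    ... | there d∈  = d∈
    cover₁ d (inj₂ (c<d , d<x)) = ⊥-elim (<-asym x<c (<-trans c<d d<x))
    cover₂ : ∀ d → Between L c y d → d ∈ cs
    cover₂ d (inj₁ (c<d , d<y)) with cover d (inj₁ (<-trans x<c c<d , d<y))
    ... | here refl = ⊥-elim (<-irrefl c<d)
    ... | there d∈  = d∈
    cover₂ d (inj₂ (y<d , d<c)) = ⊥-elim (<-asym c<y (<-trans y<d d<c))

  iterate-reaches : ∀ {x y} → x <ₗ y → x ≃[ 1 ] y → ∃ λ n → iterate n x ≡ just y
  iterate-reaches x<y (cs , _ , cover) = iterate-reaches′ cs x<y cover

lookup-injective : ∀ {c ℓ} (S : Setoid c ℓ) {xs} → Unique.Unique S xs →
  ∀ {i j} → Setoid._≈_ S (lookup xs i) (lookup xs j) → i ≡ j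
lookup-injective S {x ∷ xs} (_ ∷ _)  {zero}  {zero}  _  = refl
lookup-injective S {x ∷ xs} (x≉ ∷ _) {zero}  {suc j} eq = ⊥-elim (All.lookup x≉ (∈-lookup j) eq)
lookup-injective S {x ∷ xs} (x≉ ∷ _) {suc i} {zero}  eq = ⊥-elim (All.lookup x≉ (∈-lookup i) (Setoid.sym S eq))
lookup-injective S {x ∷ xs} (_ ∷ u)  {suc i} {suc j} eq = cong Fin.suc (lookup-injective S u eq)

record ClassRepresentatives (L : LinOrd) : Set where
  open LinearOrder L
  field
    size         : ℕ
    rep          : Fin size → Carrier
    rep-covers   : ∀ x → ∃ λ i → x ≃[ 1 ] rep i
    rep-distinct : ∀ {i j} → rep i ≃[ 1 ] rep j → i ≡ j

module _ (em : ExcludedMiddle (Level.suc 0ℓ)) (L : LinOrd) where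
  open LinearOrder L

  ≃₁-decSetoid : DecSetoid 0ℓ 0ℓ
  ≃₁-decSetoid = record
    { Carrier = Carrier
    ; _≈_     = _≃[ 1 ]_
    ; isDecEquivalence = record
      { isEquivalence = record { refl = ≃-refl 1 ; sym = ≃-sym 1 ; trans = ≃₁-trans }
      ; _≟_ = λ a b → decide em (a ≃[ 1 ] b) } }

  finitely-many-classes⇒representatives : FiniteQuot (λ _ → ⊤) (_≃[ 1 ]_) → ClassRepresentatives L
  finitely-many-classes⇒representatives (rs , _ , cover) = record
    { size         = length reps
    ; rep          = lookup reps
    ; rep-covers   = λ x →
        let x∈ = Any.deduplicate⁺ _≟_ (λ r≃r′ x≃r → ≃₁-trans x≃r (≃-sym 1 r≃r′)) (cover x tt)
        in Any.index x∈ , Any.lookup-index x∈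
    ; rep-distinct = lookup-injective setoid (deduplicate-! ≃₁-decSetoid rs) }
    where
    open DecSetoid ≃₁-decSetoid using (_≟_; setoid)
    reps : List Carrier
    reps = deduplicate _≟_ rs

-- The piece inj₁ i is the chain upwards from rep i, and inj₂ i the chain strictly below rep i.
module ChainsOfRepresentatives (em : ExcludedMiddle (Level.suc 0ℓ)) {L : LinOrd}
                               (R : ClassRepresentatives L) where
  open LinearOrder L
  open ClassRepresentatives R
  module Up   = Successors em L
  module Down = Successors em (dual L)

  Piece : Set
  Piece = Fin size ⊎ Fin size

  pieceChain : Piece → ℕ → Maybe Carrier
  pieceChain (inj₁ i) q = Up.iterate q (rep i)
  pieceChain (inj₂ i) q = Down.iterate (suc q) (rep i)

  ascendingPiece : Piece → Bool
  ascendingPiece (inj₁ _) = true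
  ascendingPiece (inj₂ _) = false

  InPiece : Piece → Carrier → Set
  InPiece (inj₁ i) e = e ≃[ 1 ] rep i × (rep i ≡ e ⊎ rep i <ₗ e)
  InPiece (inj₂ i) e = e ≃[ 1 ] rep i × e <ₗ rep i

  pieceChain-inPiece : ∀ p {q e} → pieceChain p q ≡ just e → InPiece p e
  pieceChain-inPiece (inj₁ i) {q} ↦e = ≃-sym 1 (Up.iterate-≃₁ q ↦e) , Up.iterate-≤ q ↦e
  pieceChain-inPiece (inj₂ i) {q} ↦e = ≃-sym 1 (≃-dual L 1 (Down.iterate-≃₁ (suc q) ↦e)) , Down.iterate-< q ↦e

  pieceIndex : Piece → Fin size
  pieceIndex (inj₁ i) = i
  pieceIndex (inj₂ i) = i

  inPiece-≃ : ∀ p {e} → InPiece p e → e ≃[ 1 ] rep (pieceIndex p)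
  inPiece-≃ (inj₁ _) = proj₁
  inPiece-≃ (inj₂ _) = proj₁

  from-below-absurd : ∀ {r e} → r ≡ e ⊎ r <ₗ e → ¬ e <ₗ r
  from-below-absurd (inj₁ refl) e<r = <-irrefl e<r
  from-below-absurd (inj₂ r<e)  e<r = <-asym r<e e<r

  same-class : ∀ {e} p p′ → InPiece p e → InPiece p′ e → pieceIndex p ≡ pieceIndex p′
  same-class p p′ in-p in-p′ = rep-distinct (≃₁-trans (≃-sym 1 (inPiece-≃ p in-p)) (inPiece-≃ p′ in-p′))

  inPiece-unique : ∀ p p′ {e} → InPiece p e → InPiece p′ e → p ≡ p′
  inPiece-unique p@(inj₁ _) p′@(inj₁ _) in-p in-p′ with same-class p p′ in-p in-p′
  ... | refl = refl
  inPiece-unique p@(inj₂ _) p′@(inj₂ _) in-p in-p′ with same-class p p′ in-p in-p′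
  ... | refl = refl
  inPiece-unique p@(inj₁ _) p′@(inj₂ _) in-p in-p′ with same-class p p′ in-p in-p′
  ... | refl = ⊥-elim (from-below-absurd (proj₂ in-p) (proj₂ in-p′))
  inPiece-unique p@(inj₂ _) p′@(inj₁ _) in-p in-p′ with same-class p p′ in-p in-p′
  ... | refl = ⊥-elim (from-below-absurd (proj₂ in-p′) (proj₂ in-p))

  different-classes-ordered : ∀ {i j e e′ d d′} → i ≢ j → e ≃[ 1 ] rep i → e′ ≃[ 1 ] rep j → e <ₗ e′ →
                              d ≃[ 1 ] rep i → d′ ≃[ 1 ] rep j → d <ₗ d′
  different-classes-ordered {i} {j} i≢j e≃ e′≃ e<e′ d≃ d′≃ with compare (rep i) (rep j)
  ... | tri< ri<rj _ _ = ≃₁-classes-ordered d≃ d′≃ ri<rj (i≢j ∘ rep-distinct)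
  ... | tri≈ _ ri≡rj _ = ⊥-elim (i≢j (rep-distinct (subst (rep i ≃[ 1 ]_) ri≡rj (≃-refl 1))))
  ... | tri> _ _ rj<ri =
    ⊥-elim (<-asym e<e′ (≃₁-classes-ordered e′≃ e≃ rj<ri (i≢j ∘ rep-distinct ∘ ≃-sym 1)))

  same-index-uniform : ∀ p p′ {e e′ d d′} → p ≢ p′ → pieceIndex p ≡ pieceIndex p′ →
                       InPiece p e → InPiece p′ e′ → e <ₗ e′ → InPiece p d → InPiece p′ d′ → d <ₗ d′
  same-index-uniform (inj₁ _) (inj₁ _) p≢p′ refl _ _ _ _ _ = ⊥-elim (p≢p′ refl)
  same-index-uniform (inj₂ _) (inj₂ _) p≢p′ refl _ _ _ _ _ = ⊥-elim (p≢p′ refl)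
  same-index-uniform (inj₁ _) (inj₂ _) _ refl (_ , from-below) (_ , below) e<e′ _ _ =
    ⊥-elim (from-below-absurd from-below (<-trans e<e′ below))
  same-index-uniform (inj₂ _) (inj₁ _) _ refl _ _ _ (_ , d<r) (_ , inj₁ refl) = d<r
  same-index-uniform (inj₂ _) (inj₁ _) _ refl _ _ _ (_ , d<r) (_ , inj₂ r<d′) = <-trans d<r r<d′

  inPiece-uniform : ∀ p p′ {e e′ d d′} → p ≢ p′ → InPiece p e → InPiece p′ e′ → e <ₗ e′ →
                    InPiece p d → InPiece p′ d′ → d <ₗ d′
  inPiece-uniform p p′ p≢p′ in-e in-e′ e<e′ in-d in-d′ with pieceIndex p Fin.≟ pieceIndex p′
  ... | yes i≡j = same-index-uniform p p′ p≢p′ i≡j in-e in-e′ e<e′ in-d in-d′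
  ... | no  i≢j = different-classes-ordered i≢j (inPiece-≃ p in-e) (inPiece-≃ p′ in-e′) e<e′
                    (inPiece-≃ p in-d) (inPiece-≃ p′ in-d′)

  pieceChain-covers : ∀ e → ∃₂ λ p q → pieceChain p q ≡ just e
  pieceChain-covers e with rep-covers e
  ... | i , e≃ with compare e (rep i)
  ...   | tri≈ _ e≡r _ = inj₁ i , 0 , cong just (sym e≡r)
  ...   | tri> _ _ r<e = let (n , ↦e) = Up.iterate-reaches r<e (≃-sym 1 e≃) in inj₁ i , n , ↦e
  ...   | tri< e<r _ _ with Down.iterate-reaches e<r (≃-dual (dual L) 1 (≃-sym 1 e≃))
  ...     | zero  , refl = ⊥-elim (<-irrefl e<r)
  ...     | suc q , ↦e   = inj₂ i , q , ↦e

  pieceChain-downward : ∀ p q {e} → pieceChain p (suc q) ≡ just e → ∃ λ d → pieceChain p q ≡ just d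
  pieceChain-downward (inj₁ _) q = Up.iterate-downward q
  pieceChain-downward (inj₂ _) q = Down.iterate-downward (suc q)

  pieceChain-strict : ∀ p {q q′ e e′} → pieceChain p q ≡ just e → pieceChain p q′ ≡ just e′ →
                      Oriented (ascendingPiece p) q q′ → e <ₗ e′
  pieceChain-strict (inj₁ _) {q} {q′} ↦e ↦e′ q<q′ = Up.iterate-strict q q′ ↦e ↦e′ q<q′
  pieceChain-strict (inj₂ _) {q} {q′} ↦e ↦e′ q′<q = Down.iterate-strict (suc q′) (suc q) ↦e′ ↦e (s≤s q′<q)

  splitAt-injective : ∀ {a a′ : Fin (size + size)} → splitAt size a ≡ splitAt size a′ → a ≡ a′
  splitAt-injective {a} {a′} eq =
    trans (sym (join-splitAt size size a)) (trans (cong (join size size) eq) (join-splitAt size size a′))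

  chainDecomposition : ChainDecomposition L (size + size)
  chainDecomposition = record
    { chain          = λ a → pieceChain (splitAt size a)
    ; ascending      = λ a → ascendingPiece (splitAt size a)
    ; chain-downward = λ a → pieceChain-downward (splitAt size a)
    ; chain-covers   = covers
    ; chain-disjoint = λ {a} {a′} ↦e ↦e′ → splitAt-injective (inPiece-unique _ _
        (pieceChain-inPiece (splitAt size a) ↦e) (pieceChain-inPiece (splitAt size a′) ↦e′))
    ; chain-strict   = λ {a} → pieceChain-strict (splitAt size a)
    ; chain-uniform  = λ {a} {a′} a≢a′ ↦e ↦e′ e<e′ ↦d ↦d′ →
        inPiece-uniform (splitAt size a) (splitAt size a′) (a≢a′ ∘ splitAt-injective)
          (pieceChain-inPiece _ ↦e) (pieceChain-inPiece _ ↦e′) e<e′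
          (pieceChain-inPiece _ ↦d) (pieceChain-inPiece _ ↦d′)
    }
    where
    covers : ∀ e → ∃₂ λ a q → pieceChain (splitAt size a) q ≡ just e
    covers e with pieceChain-covers e
    ... | p , q , ↦e =
      join size size p , q , subst (λ p → pieceChain p q ≡ just e) (sym (splitAt-join size size p)) ↦e

-- The orders Lₛ

Lex : ℕ → ℕ → ℕ → ℕ → Set
Lex i j a b = i < j ⊎ (i ≡ j × a < b)

lex-trans : ∀ {i j k a b c} → Lex i j a b → Lex j k b c → Lex i k a c
lex-trans (inj₁ p)          (inj₁ q)          = inj₁ (ℕ.<-trans p q)
lex-trans (inj₁ p)          (inj₂ (refl , _)) = inj₁ p
lex-trans (inj₂ (refl , _)) (inj₁ q)          = inj₁ q
lex-trans (inj₂ (refl , p)) (inj₂ (refl , q)) = inj₂ (refl , ℕ.<-trans p q)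

lex-trans-rev : ∀ {i j k a b c} → Lex i j b a → Lex j k c b → Lex i k c a
lex-trans-rev (inj₁ p)          (inj₁ q)          = inj₁ (ℕ.<-trans p q)
lex-trans-rev (inj₁ p)          (inj₂ (refl , _)) = inj₁ p
lex-trans-rev (inj₂ (refl , _)) (inj₁ q)          = inj₁ q
lex-trans-rev (inj₂ (refl , p)) (inj₂ (refl , q)) = inj₂ (refl , ℕ.<-trans q p)

lex⇒≤ : ∀ {i j a b} → Lex i j a b → i ≤ j
lex⇒≤ (inj₁ p)          = ℕ.<⇒≤ p
lex⇒≤ (inj₂ (refl , _)) = ℕ.≤-refl

lex-irrefl : ∀ {i a} → ¬ Lex i i a a
lex-irrefl (inj₁ p)       = ℕ.<-irrefl refl p
lex-irrefl (inj₂ (_ , p)) = ℕ.<-irrefl refl p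

lex-same-block : ∀ {i a b} → Lex i i a b → a < b
lex-same-block (inj₁ p)       = ⊥-elim (ℕ.<-irrefl refl p)
lex-same-block (inj₂ (_ , p)) = p

lex-asym-suc : ∀ {i j m n} → Lex i j m n → ¬ Lex j i n (suc m)
lex-asym-suc (inj₁ p)          (inj₁ q)          = ℕ.<-asym p q
lex-asym-suc (inj₁ p)          (inj₂ (refl , _)) = ℕ.<-irrefl refl p
lex-asym-suc (inj₂ (refl , _)) (inj₁ q)          = ℕ.<-irrefl refl q
lex-asym-suc (inj₂ (refl , p)) (inj₂ (_ , q))    = ℕ.<⇒≱ q p

-- up i, fin i and down i enumerate the parts ω, Fᵢ and ω* of the i-th summand of Lₛ.
module Blocks (s : ℕ → Bool) where

  blockSize : ℕ → ℕ
  blockSize i = if s i then suc i else 0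

  data Point : Set where
    up   : ℕ → ℕ → Point
    fin  : (i : ℕ) → Fin (blockSize i) → Point
    down : ℕ → ℕ → Point

  infix 4 _≺_

  _≺_ : Point → Point → Set
  up i n   ≺ up j m   = Lex i j n m
  up i n   ≺ fin j k  = i ≤ j
  up i n   ≺ down j m = i ≤ j
  fin i k  ≺ up j m   = i < j
  fin i k  ≺ fin j k′ = Lex i j (toℕ k) (toℕ k′)
  fin i k  ≺ down j m = i ≤ j
  down i n ≺ up j m   = i < j
  down i n ≺ fin j k  = i < j
  down i n ≺ down j m = Lex i j m n

  ≺-trans : ∀ {x y z} → x ≺ y → y ≺ z → x ≺ z
  ≺-trans {up _ _}   {up _ _}   {up _ _}   p q = lex-trans p q
  ≺-trans {up _ _}   {up _ _}   {fin _ _}  p q = ℕ.≤-trans (lex⇒≤ p) q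
  ≺-trans {up _ _}   {up _ _}   {down _ _} p q = ℕ.≤-trans (lex⇒≤ p) q
  ≺-trans {up _ _}   {fin _ _}  {up _ _}   p q = inj₁ (ℕ.≤-<-trans p q)
  ≺-trans {up _ _}   {fin _ _}  {fin _ _}  p q = ℕ.≤-trans p (lex⇒≤ q)
  ≺-trans {up _ _}   {fin _ _}  {down _ _} p q = ℕ.≤-trans p q
  ≺-trans {up _ _}   {down _ _} {up _ _}   p q = inj₁ (ℕ.≤-<-trans p q)
  ≺-trans {up _ _}   {down _ _} {fin _ _}  p q = ℕ.<⇒≤ (ℕ.≤-<-trans p q)
  ≺-trans {up _ _}   {down _ _} {down _ _} p q = ℕ.≤-trans p (lex⇒≤ q)
  ≺-trans {fin _ _}  {up _ _}   {up _ _}   p q = ℕ.<-≤-trans p (lex⇒≤ q)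
  ≺-trans {fin _ _}  {up _ _}   {fin _ _}  p q = inj₁ (ℕ.<-≤-trans p q)
  ≺-trans {fin _ _}  {up _ _}   {down _ _} p q = ℕ.<⇒≤ (ℕ.<-≤-trans p q)
  ≺-trans {fin _ _}  {fin _ _}  {up _ _}   p q = ℕ.≤-<-trans (lex⇒≤ p) q
  ≺-trans {fin _ a}  {fin _ b}  {fin _ c}  p q = lex-trans {a = toℕ a} {b = toℕ b} {c = toℕ c} p q
  ≺-trans {fin _ _}  {fin _ _}  {down _ _} p q = ℕ.≤-trans (lex⇒≤ p) q
  ≺-trans {fin _ _}  {down _ _} {up _ _}   p q = ℕ.≤-<-trans p q
  ≺-trans {fin _ _}  {down _ _} {fin _ _}  p q = inj₁ (ℕ.≤-<-trans p q)
  ≺-trans {fin _ _}  {down _ _} {down _ _} p q = ℕ.≤-trans p (lex⇒≤ q)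
  ≺-trans {down _ _} {up _ _}   {up _ _}   p q = ℕ.<-≤-trans p (lex⇒≤ q)
  ≺-trans {down _ _} {up _ _}   {fin _ _}  p q = ℕ.<-≤-trans p q
  ≺-trans {down _ _} {up _ _}   {down _ _} p q = inj₁ (ℕ.<-≤-trans p q)
  ≺-trans {down _ _} {fin _ _}  {up _ _}   p q = ℕ.<-trans p q
  ≺-trans {down _ _} {fin _ _}  {fin _ _}  p q = ℕ.<-≤-trans p (lex⇒≤ q)
  ≺-trans {down _ _} {fin _ _}  {down _ _} p q = inj₁ (ℕ.<-≤-trans p q)
  ≺-trans {down _ _} {down _ _} {up _ _}   p q = ℕ.≤-<-trans (lex⇒≤ p) q
  ≺-trans {down _ _} {down _ _} {fin _ _}  p q = ℕ.≤-<-trans (lex⇒≤ p) q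
  ≺-trans {down _ _} {down _ _} {down _ _} p q = lex-trans-rev p q

  ≺-irrefl : ∀ {x} → ¬ x ≺ x
  ≺-irrefl {up _ _}   = lex-irrefl
  ≺-irrefl {fin _ _}  = lex-irrefl
  ≺-irrefl {down _ _} = lex-irrefl

  ≺-asym : ∀ {x y} → x ≺ y → ¬ y ≺ x
  ≺-asym p q = ≺-irrefl (≺-trans p q)

  private
    lex-connex : ∀ i j a b → Lex i j a b ⊎ ((i ≡ j × a ≡ b) ⊎ Lex j i b a)
    lex-connex i j a b with ℕ.<-cmp i j
    ... | tri< i<j _ _ = inj₁ (inj₁ i<j)
    ... | tri> _ _ j<i = inj₂ (inj₂ (inj₁ j<i))
    ... | tri≈ _ refl _ with ℕ.<-cmp a b
    ...   | tri< a<b _ _ = inj₁ (inj₂ (refl , a<b))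
    ...   | tri≈ _ a≡b _ = inj₂ (inj₁ (refl , a≡b))
    ...   | tri> _ _ b<a = inj₂ (inj₂ (inj₂ (refl , b<a)))

    ≤-connex : ∀ i j → i ≤ j ⊎ j < i
    ≤-connex i j with i ℕ.≤? j
    ... | yes i≤j = inj₁ i≤j
    ... | no  i≰j = inj₂ (ℕ.≰⇒> i≰j)

    after : ∀ {A B C : Set} → C → A ⊎ (B ⊎ C)
    after c = inj₂ (inj₂ c)

    connex : ∀ x y → x ≺ y ⊎ (x ≡ y ⊎ y ≺ x)
    connex (up i n) (up j m) with lex-connex i j n m
    ... | inj₁ p                  = inj₁ p
    ... | inj₂ (inj₁ (refl , refl)) = inj₂ (inj₁ refl)
    ... | inj₂ (inj₂ p)           = inj₂ (inj₂ p)
    connex (fin i k) (fin j k′) with lex-connex i j (toℕ k) (toℕ k′)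
    ... | inj₁ p                  = inj₁ p
    ... | inj₂ (inj₁ (refl , e))  = inj₂ (inj₁ (cong (fin i) (toℕ-injective e)))
    ... | inj₂ (inj₂ p)           = inj₂ (inj₂ p)
    connex (down i n) (down j m) with lex-connex i j m n
    ... | inj₁ p                  = inj₁ p
    ... | inj₂ (inj₁ (refl , refl)) = inj₂ (inj₁ refl)
    ... | inj₂ (inj₂ p)           = inj₂ (inj₂ p)
    connex (up i _)   (fin j _)  = [ inj₁ , after ]′ (≤-connex i j)
    connex (up i _)   (down j _) = [ inj₁ , after ]′ (≤-connex i j)
    connex (fin i _)  (down j _) = [ inj₁ , after ]′ (≤-connex i j)
    connex (fin i _)  (up j _)   = [ after , inj₁ ]′ (≤-connex j i)
    connex (down i _) (up j _)   = [ after , inj₁ ]′ (≤-connex j i)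
    connex (down i _) (fin j _)  = [ after , inj₁ ]′ (≤-connex j i)

  ≺-compare : ∀ x y → Tri (x ≺ y) (x ≡ y) (y ≺ x)
  ≺-compare x y with connex x y
  ... | inj₁ p           = tri< p (λ { refl → ≺-irrefl p }) (≺-asym p)
  ... | inj₂ (inj₁ refl) = tri≈ ≺-irrefl refl ≺-irrefl
  ... | inj₂ (inj₂ q)    = tri> (λ p → ≺-asym p q) (λ { refl → ≺-irrefl q }) q

  order : LinOrd
  order = record
    { Carrier = Point
    ; _<ₗ_    = _≺_
    ; isSTO   = record
      { isStrictPartialOrder = record
        { isEquivalence = isEquivalence
        ; irrefl        = λ { refl → ≺-irrefl }
        ; trans         = ≺-trans
        ; <-resp-≈      = (λ { refl p → p }) , (λ { refl p → p }) }
      ; compare = ≺-compare } }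

  open LinearOrder order using (_⋖_; ⋖-unique)
  open Components order using (NoPred; NoSucc; EndsAfter)

  block-nonempty : ∀ i → Fin (blockSize i) → s i ≡ true
  block-nonempty i k with s i
  ... | true  = refl
  ... | false with k
  ...   | ()

  blockSize-true : ∀ i → s i ≡ true → blockSize i ≡ suc i
  blockSize-true i si rewrite si = refl

  toℕ≤block : ∀ i (k : Fin (blockSize i)) → toℕ k ≤ i
  toℕ≤block i k = ℕ.m<1+n⇒m≤n (subst (toℕ k <_) (blockSize-true i (block-nonempty i k)) (toℕ<n k))

  fin-index : ∀ {i j} → j ≤ i → s i ≡ true → Fin (blockSize i)
  fin-index {i} {j} j≤i si = fromℕ< (subst (j <_) (sym (blockSize-true i si)) (s≤s j≤i))

  up-⋖ : ∀ i m → up i m ⋖ up i (suc m)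
  up-⋖ i m = inj₂ (refl , ℕ.≤-refl) , λ
    { (up j n)   p q → lex-asym-suc p q
    ; (fin j k)  p q → ℕ.≤⇒≯ p q
    ; (down j n) p q → ℕ.≤⇒≯ p q }

  down-⋖ : ∀ i m → down i (suc m) ⋖ down i m
  down-⋖ i m = inj₂ (refl , ℕ.≤-refl) , λ
    { (up j n)   p q → ℕ.≤⇒≯ q p
    ; (fin j k)  p q → ℕ.≤⇒≯ q p
    ; (down j n) p q → lex-asym-suc q p }

  down-⋖-up : ∀ i → down i 0 ⋖ up (suc i) 0
  down-⋖-up i = ℕ.≤-refl , λ
    { (up j n)   p (inj₁ q)        → ℕ.≤⇒≯ p q
    ; (up j n)   p (inj₂ (_ , ())) 
    ; (fin j k)  p q               → ℕ.≤⇒≯ p q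
    ; (down j n) (inj₁ p) q        → ℕ.≤⇒≯ p q
    ; (down j n) (inj₂ (_ , ())) q }

  fin-⋖ : ∀ i (k k′ : Fin (blockSize i)) → toℕ k′ ≡ suc (toℕ k) → fin i k ⋖ fin i k′
  fin-⋖ i k k′ k′≡1+k = inj₂ (refl , subst (toℕ k <_) (sym k′≡1+k) ℕ.≤-refl) , λ
    { (up j n)    p q → ℕ.≤⇒≯ q p
    ; (fin j k″)  p q → lex-asym-suc p (subst (Lex _ i (toℕ k″)) k′≡1+k q)
    ; (down j n)  p q → ℕ.≤⇒≯ p q }

  fin-last-NoSucc : ∀ i (k : Fin (blockSize i)) → toℕ k ≡ i → NoSucc (fin i k)
  fin-last-NoSucc i k k≡i (up j n)   (p , nothing-between) = nothing-between (down i 0) ℕ.≤-refl p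
  fin-last-NoSucc i k k≡i (fin j k′) (inj₁ p , nothing-between) = nothing-between (down i 0) ℕ.≤-refl p
  fin-last-NoSucc i k k≡i (fin j k′) (inj₂ (refl , p) , _) =
    ℕ.≤⇒≯ (toℕ≤block i k′) (subst (_< toℕ k′) k≡i p)
  fin-last-NoSucc i k k≡i (down j n) (p , nothing-between) = nothing-between (down j (suc n)) p (inj₂ (refl , ℕ.≤-refl))

  fin-first-NoPred : ∀ i (k : Fin (blockSize i)) → toℕ k ≡ 0 → NoPred (fin i k)
  fin-first-NoPred i k k≡0 (up j m)   (p , nothing-between) = nothing-between (up j (suc m)) (inj₂ (refl , ℕ.≤-refl)) p
  fin-first-NoPred i k k≡0 (fin j k′) (inj₁ p , nothing-between) = nothing-between (down j 0) ℕ.≤-refl p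
  fin-first-NoPred i k k≡0 (fin j k′) (inj₂ (refl , p) , _) = ℕ.n≮0 (subst (toℕ k′ <_) k≡0 p)
  fin-first-NoPred i k k≡0 (down j m) (p , nothing-between) = nothing-between (up (suc j) 0) ℕ.≤-refl p

  fin-EndsAfter : ∀ i → (si : s i ≡ true) → ∀ d j (j≤i : j ≤ i) → d + j ≡ i →
                  EndsAfter d (fin i (fin-index j≤i si))
  fin-EndsAfter i si zero    j j≤i j≡i = fin-last-NoSucc i _ (trans (toℕ-fromℕ< _) j≡i)
  fin-EndsAfter i si (suc d) j j≤i d+j≡i =
    fin i (fin-index j<i si) ,
    fin-⋖ i _ _ (trans (toℕ-fromℕ< _) (cong suc (sym (toℕ-fromℕ< _)))) ,
    fin-EndsAfter i si d (suc j) j<i (trans (ℕ.+-suc d j) d+j≡i)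
    where
    j<i : suc j ≤ i
    j<i = subst (suc j ≤_) d+j≡i (s≤s (ℕ.m≤n+m j d))

  up-never-ends : ∀ d i m → ¬ EndsAfter d (up i m)
  up-never-ends zero    i m no-succ = no-succ _ (up-⋖ i m)
  up-never-ends (suc d) i m (y , m⋖y , ends) with ⋖-unique m⋖y (up-⋖ i m)
  ... | refl = up-never-ends d i (suc m) ends

  fin-EndsAfter-position : ∀ d i (k : Fin (blockSize i)) → EndsAfter d (fin i k) → d + toℕ k ≡ i
  fin-EndsAfter-position d i k ends with ℕ.m≤n⇒m<n∨m≡n (toℕ≤block i k)
  fin-EndsAfter-position zero    i k no-succ | inj₁ k<i =
    ⊥-elim (no-succ _ (fin-⋖ i k (fin-index k<i (block-nonempty i k)) (toℕ-fromℕ< _)))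
  fin-EndsAfter-position (suc d) i k (y , k⋖y , ends) | inj₁ k<i
    with ⋖-unique k⋖y (fin-⋖ i k (fin-index k<i (block-nonempty i k)) (toℕ-fromℕ< _))
  ... | refl = trans (sym (ℕ.+-suc d (toℕ k)))
                 (trans (cong (d +_) (sym (toℕ-fromℕ< _))) (fin-EndsAfter-position d i _ ends))
  fin-EndsAfter-position zero    i k ends | inj₂ k≡i = k≡i
  fin-EndsAfter-position (suc d) i k (y , k⋖y , _) | inj₂ k≡i = ⊥-elim (fin-last-NoSucc i k k≡i y k⋖y)

  component-of-block : ∀ n → s n ≡ true → HasFiniteComponent order n
  component-of-block n sn =
    fin n (fin-index z≤n sn) , fin-first-NoPred n _ (toℕ-fromℕ< _) ,
    fin-EndsAfter n sn n 0 z≤n (ℕ.+-identityʳ n)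

  block-of-component : ∀ n → HasFiniteComponent order n → s n ≡ true
  block-of-component n (up zero zero , _ , ends)        = ⊥-elim (up-never-ends n 0 0 ends)
  block-of-component n (up (suc i) zero , no-pred , _)  = ⊥-elim (no-pred (down i 0) (down-⋖-up i))
  block-of-component n (up i (suc m) , no-pred , _)     = ⊥-elim (no-pred (up i m) (up-⋖ i m))
  block-of-component n (down i m , no-pred , _)         = ⊥-elim (no-pred (down i (suc m)) (down-⋖ i m))
  block-of-component n (fin i k , no-pred , ends) with toℕ k in k≡
  ... | zero  = subst (λ u → s u ≡ true)
                  (trans (sym (fin-EndsAfter-position n i k ends)) (trans (cong (n +_) k≡) (ℕ.+-identityʳ n)))
                  (block-nonempty i k)
  ... | suc j = ⊥-elim (no-pred (fin i prev) (fin-⋖ i prev k (trans k≡ (cong suc (sym (toℕ-fromℕ< _))))))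
    where
    prev : Fin (blockSize i)
    prev = fromℕ< (ℕ.<-trans (ℕ.n<1+n j) (subst (_< blockSize i) k≡ (toℕ<n k)))

module BlocksRank (s : ℕ → Bool) where
  open Blocks s
  open LinearOrder order

  block : Point → ℕ
  block (up i _)   = i
  block (fin i _)  = i
  block (down i _) = i

  block-mono : ∀ {x y} → x ≺ y → block x ≤ block y
  block-mono {up _ _}   {up _ _}   p = lex⇒≤ p
  block-mono {up _ _}   {fin _ _}  p = p
  block-mono {up _ _}   {down _ _} p = p
  block-mono {fin _ _}  {up _ _}   p = ℕ.<⇒≤ p
  block-mono {fin _ _}  {fin _ _}  p = lex⇒≤ p
  block-mono {fin _ _}  {down _ _} p = p
  block-mono {down _ _} {up _ _}   p = ℕ.<⇒≤ p
  block-mono {down _ _} {fin _ _}  p = ℕ.<⇒≤ p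
  block-mono {down _ _} {down _ _} p = lex⇒≤ p

  up-≃₁ : ∀ i m → up i 0 ≃[ 1 ] up i m
  up-≃₁ i zero    = ≃-refl 1
  up-≃₁ i (suc m) = ≃₁-trans (up-≃₁ i m) (⋖⇒≃ 0 (up-⋖ i m))

  down-≃₁ : ∀ i m → down i m ≃[ 1 ] down i 0
  down-≃₁ i zero    = ≃-refl 1
  down-≃₁ i (suc m) = ≃₁-trans (⋖⇒≃ 0 (down-⋖ i m)) (down-≃₁ i m)

  ≃-trans-≤ : ∀ n {a b c} → a ≺ b ⊎ a ≡ b → b ≺ c → a ≃[ suc n ] b → b ≃[ suc n ] c → a ≃[ suc n ] c
  ≃-trans-≤ n (inj₁ a≺b) b≺c = ≃-trans-< n a≺b b≺c
  ≃-trans-≤ n (inj₂ refl) _  _ b≃c = b≃c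

  downBelow : Point → ℕ → Point
  downBelow (down _ m) i = down i (suc m)
  downBelow _          i = down i 0

  up0≺downBelow : ∀ x → up (block x) 0 ≺ downBelow x (block x)
  up0≺downBelow (up _ _)   = ℕ.≤-refl
  up0≺downBelow (fin _ _)  = ℕ.≤-refl
  up0≺downBelow (down _ _) = ℕ.≤-refl

  downBelow-≺ : ∀ x m → down (block x) m ≺ x →
                downBelow x (block x) ≺ x × down (block x) m ≃[ 1 ] downBelow x (block x)
  downBelow-≺ (up _ _)   m p = ⊥-elim (ℕ.<-irrefl refl p)
  downBelow-≺ (fin _ _)  m p = ⊥-elim (ℕ.<-irrefl refl p)
  downBelow-≺ (down j m′) m (inj₁ p)       = ⊥-elim (ℕ.<-irrefl refl p)
  downBelow-≺ (down j m′) m (inj₂ (_ , _)) =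
    inj₂ (refl , ℕ.≤-refl) , ≃₁-trans (down-≃₁ j m) (≃-sym 1 (down-≃₁ j (suc m′)))

  up1≺ : ∀ i m x → up i (suc m) ≺ x → up i 1 ≺ x
  up1≺ i zero    x p = p
  up1≺ i (suc m) x p = ≺-trans {up i 1} {up i (suc (suc m))} {x} (inj₂ (refl , s≤s (s≤s z≤n))) p

  -- between up i 0 and x lie only points ≃₁ to up i 1, points of Fᵢ, and points ≃₁ to downBelow x i
  block-≃₂ : ∀ x → up (block x) 0 ≺ x → up (block x) 0 ≃[ 2 ] x
  block-≃₂ x up0≺x = finiteQuot-filter (between? (up i 0) x) candidates cover
    where
    i : ℕ
    i = block x
    candidates : List Point
    candidates = up i 1 ∷ downBelow x i ∷ map (fin i) (allFin (blockSize i))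
    cover : ∀ c → Between order (up i 0) x c →
            Any (λ r → Between order (up i 0) x r × c ≃[ 1 ] r) candidates
    cover c (inj₂ (p , q)) = ⊥-elim (≺-irrefl {up i 0} (≺-trans {up i 0} up0≺x (≺-trans {x} p q)))
    cover (up j m) (inj₁ (p , q)) with ℕ.≤-antisym (lex⇒≤ p) (block-mono q)
    cover (up j m)       (inj₁ (inj₁ p , q)) | refl = ⊥-elim (ℕ.<-irrefl refl p)
    cover (up j (suc m)) (inj₁ (inj₂ (refl , _) , q)) | refl =
      here (inj₁ (inj₂ (refl , s≤s z≤n) , up1≺ i m x q) ,
            ≃₁-trans (≃-sym 1 (up-≃₁ i (suc m))) (up-≃₁ i 1))
    cover (fin j k) (inj₁ (p , q)) with ℕ.≤-antisym p (block-mono q)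
    ... | refl = there (there (Any.map⁺ (Any.map (λ { refl → inj₁ (p , q) , ≃-refl 1 }) (∈-allFin k))))
    cover (down j m) (inj₁ (p , q)) with ℕ.≤-antisym p (block-mono q)
    ... | refl with downBelow-≺ x m q
    ...   | below , m≃ = there (here (inj₁ (up0≺downBelow x , below) , m≃))

  up00-≼ : ∀ i → up 0 0 ≺ up i 0 ⊎ up 0 0 ≡ up i 0
  up00-≼ zero    = inj₂ refl
  up00-≼ (suc i) = inj₁ (inj₁ (s≤s z≤n))

  up00-≃₂-up : ∀ i → up 0 0 ≃[ 2 ] up i 0
  up00-≃₂-up zero    = ≃-refl 2
  up00-≃₂-up (suc i) = ≃-trans-< 1 {up 0 0} {down i 0} {up (suc i) 0} z≤n ℕ.≤-refl
    (≃-trans-≤ 1 (up00-≼ i) ℕ.≤-refl (up00-≃₂-up i) (block-≃₂ (down i 0) ℕ.≤-refl))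
    (⋖⇒≃ 1 (down-⋖-up i))

  up00-≃₂-via-block : ∀ x → up (block x) 0 ≺ x → up 0 0 ≃[ 2 ] x
  up00-≃₂-via-block x up0≺x =
    ≃-trans-≤ 1 (up00-≼ (block x)) up0≺x (up00-≃₂-up (block x)) (block-≃₂ x up0≺x)

  up00-≃₂ : ∀ x → up 0 0 ≃[ 2 ] x
  up00-≃₂ (up i zero)    = up00-≃₂-up i
  up00-≃₂ (up i (suc m)) = up00-≃₂-via-block (up i (suc m)) (inj₂ (refl , s≤s z≤n))
  up00-≃₂ (fin i k)      = up00-≃₂-via-block (fin i k) ℕ.≤-refl
  up00-≃₂ (down i m)     = up00-≃₂-via-block (down i m) ℕ.≤-refl

  position : Point → ℕ
  position (up _ m) = m
  position _        = 0

  below-up : ∀ r N k → block r < N → r ≺ up N k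
  below-up (up i m)   N k p = inj₁ p
  below-up (fin i x)  N k p = p
  below-up (down i m) N k p = p

  -- down N 0 with N beyond all representatives' blocks is ≃₁ to one of them,
  -- yet infinitely many points up N k lie in between
  infinitely-many-≃₁-classes : ¬ FiniteQuot (λ _ → ⊤) (_≃[ 1 ]_)
  infinitely-many-≃₁-classes (rs , _ , cover) =
    let N = suc (sum (map block rs))
        (r , (between , _ , between-cover) , r≤) = Any-≤-sum block (cover (down N 0) tt)
        k = suc (sum (map position between))
        up≺down = inj₂ (below-up r N k (s≤s r≤) , ℕ.≤-refl)
        (e , up≡e , e≤) = Any-≤-sum position (between-cover (up N k) up≺down)
    in ℕ.<-irrefl refl (subst (λ e → position e ≤ sum (map position between)) (sym up≡e) e≤)

  has-rank-2 : HasVDRank order 2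
  has-rank-2 = ([ up 0 0 ] , tt ∷ [] , λ x _ → here (≃-sym 2 (up00-≃₂ x))) , λ
    { zero          _ (rs , ⊤s , cover) →
        infinitely-many-≃₁-classes (rs , ⊤s , λ x p → Any.map (≃-mono 0) (cover x p))
    ; (suc zero)    _ → infinitely-many-≃₁-classes
    ; (suc (suc k)) (s≤s (s≤s ())) }

  piece : Point → ℕ
  piece (up _ _)   = 0
  piece (fin _ _)  = 1
  piece (down _ _) = 2

  piece<3 : ∀ x → piece x < 3
  piece<3 (up _ _)   = s≤s z≤n
  piece<3 (fin _ _)  = s≤s (s≤s z≤n)
  piece<3 (down _ _) = s≤s (s≤s (s≤s z≤n))

  -- index of the piece (ω, Fᵢ or ω* of block i) containing x, in increasing order
  rank : Point → ℕ
  rank x = piece x + block x * 3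

  rank-mono : ∀ {x y} → x ≺ y → rank x ≤ rank y
  rank-mono {x} {y} x≺y with ℕ.m≤n⇒m<n∨m≡n (block-mono x≺y)
  ... | inj₁ bx<by = ℕ.<⇒≤ (ℕ.≤-trans (digit+<digit 3 bx<by (piece<3 x)) (ℕ.m≤n+m _ (piece y)))
  ... | inj₂ bx≡by = ℕ.+-mono-≤ (piece-mono x y bx≡by x≺y) (ℕ.≤-reflexive (cong (_* 3) bx≡by))
    where
    piece-mono : ∀ x y → block x ≡ block y → x ≺ y → piece x ≤ piece y
    piece-mono (up _ _)   _          _    _ = z≤n
    piece-mono (fin _ _)  (up _ _)   refl p = ⊥-elim (ℕ.<-irrefl refl p)
    piece-mono (fin _ _)  (fin _ _)  _    _ = ℕ.≤-refl
    piece-mono (fin _ _)  (down _ _) _    _ = s≤s z≤n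
    piece-mono (down _ _) (up _ _)   refl p = ⊥-elim (ℕ.<-irrefl refl p)
    piece-mono (down _ _) (fin _ _)  refl p = ⊥-elim (ℕ.<-irrefl refl p)
    piece-mono (down _ _) (down _ _) _    _ = ℕ.≤-refl

  data SamePiece : Point → Point → Set where
    up   : ∀ i m n → SamePiece (up i m) (up i n)
    fin  : ∀ i k k′ → SamePiece (fin i k) (fin i k′)
    down : ∀ i m n → SamePiece (down i m) (down i n)

  same-rank⇒SamePiece : ∀ x y → rank x ≡ rank y → SamePiece x y
  same-rank⇒SamePiece x y eq with digits-unique 3 {block x} {block y} (piece<3 x) (piece<3 y) eq
  same-rank⇒SamePiece (up i m)   (up .i n)   _ | refl , _ = up i m n
  same-rank⇒SamePiece (fin i k)  (fin .i k′) _ | refl , _ = fin i k k′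
  same-rank⇒SamePiece (down i m) (down .i n) _ | refl , _ = down i m n
  same-rank⇒SamePiece (up _ _)   (fin _ _)   _ | _ , ()
  same-rank⇒SamePiece (up _ _)   (down _ _)  _ | _ , ()
  same-rank⇒SamePiece (fin _ _)  (up _ _)    _ | _ , ()
  same-rank⇒SamePiece (fin _ _)  (down _ _)  _ | _ , ()
  same-rank⇒SamePiece (down _ _) (up _ _)    _ | _ , ()
  same-rank⇒SamePiece (down _ _) (fin _ _)   _ | _ , ()

  distance : Point → Point → ℕ
  distance (up _ m)   (up _ n)   = n ∸ m
  distance (fin _ k)  (fin _ k′) = toℕ k′ ∸ toℕ k
  distance (down _ m) (down _ n) = m ∸ n
  distance _          _          = 0

  distance-shrinks : ∀ {a b c} → SamePiece a c → SamePiece a b → a ≺ c → c ≺ b → distance a c < distance a b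
  distance-shrinks (up _ _ _)   (up _ _ _)   a≺c c≺b = ℕ.∸-monoˡ-< (lex-same-block c≺b) (ℕ.<⇒≤ (lex-same-block a≺c))
  distance-shrinks (fin _ _ _)  (fin _ _ _)  a≺c c≺b = ℕ.∸-monoˡ-< (lex-same-block c≺b) (ℕ.<⇒≤ (lex-same-block a≺c))
  distance-shrinks (down _ _ _) (down _ _ _) a≺c c≺b = ℕ.∸-monoʳ-< (lex-same-block c≺b) (ℕ.<⇒≤ (lex-same-block a≺c))

  module _ (S : Point → Set) (dense : DenseSub order S) where

    no-dense-pair-in-piece : ∀ d a b → S a → S b → a ≺ b → rank a ≡ rank b → distance a b ≤ d → ⊥
    no-dense-pair-in-piece d a b sa sb a≺b same≤ dist≤ with dense a b sa sb a≺b
    ... | c , sc , a≺c , c≺b with ℕ.≤-antisym (rank-mono a≺c) (subst (rank c ≤_) (sym same≤) (rank-mono c≺b))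
    ... | same-ac with distance-shrinks (same-rank⇒SamePiece a c same-ac) (same-rank⇒SamePiece a b same≤) a≺c c≺b
    no-dense-pair-in-piece zero    a b _ _ _ _ dist≤ | _ | _ | shrinks = ℕ.n≮0 (ℕ.≤-trans shrinks dist≤)
    no-dense-pair-in-piece (suc d) a b sa _ _ _ dist≤ | c , sc , a≺c , _ | same-ac | shrinks =
      no-dense-pair-in-piece d a c sa sc a≺c same-ac (ℕ.≤-pred (ℕ.≤-trans shrinks dist≤))

    no-dense-pair′ : ∀ n a b → S a → S b → a ≺ b → rank b ∸ rank a ≤ n → ⊥
    no-dense-pair′ zero a b sa sb a≺b gap≤ =
      no-dense-pair-in-piece _ a b sa sb a≺b
        (ℕ.≤-antisym (rank-mono a≺b) (ℕ.m∸n≡0⇒m≤n (ℕ.n≤0⇒n≡0 gap≤))) ℕ.≤-refl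
    no-dense-pair′ (suc n) a b sa sb a≺b gap≤ with dense a b sa sb a≺b
    ... | c , sc , a≺c , c≺b with ℕ.m≤n⇒m<n∨m≡n (rank-mono a≺c)
    ... | inj₂ same = no-dense-pair-in-piece _ a c sa sc a≺c same ℕ.≤-refl
    ... | inj₁ rank-up =
      no-dense-pair′ n c b sc sb c≺b (ℕ.≤-pred (ℕ.≤-trans (ℕ.∸-monoʳ-< rank-up (rank-mono c≺b)) gap≤))

    no-dense-pair : ∀ a b → S a → S b → ¬ a ≺ b
    no-dense-pair a b sa sb a≺b = no-dense-pair′ _ a b sa sb a≺b ℕ.≤-refl

  scattered : Scattered order
  scattered (S , dense , infinite) =
    infinite ([] , [] , λ x sx → ⊥-elim (infinite ([ x ] , sx ∷ [] , λ y sy → here (unique sy sx))))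
    where
    unique : ∀ {y x} → S y → S x → y ≡ x
    unique {y} {x} sy sx with ≺-compare y x
    ... | tri< y≺x _ _ = ⊥-elim (no-dense-pair S dense y x sy sx y≺x)
    ... | tri≈ _ y≡x _ = y≡x
    ... | tri> _ _ x≺y = ⊥-elim (no-dense-pair S dense x y sx sy x≺y)

-- Interpretations, Gödel numbers and the diagonal order

Formulas : Set
Formulas = Formula × Formula × Formula

formulas : ∀ {m L} → Interpretation m L → Formulas
formulas I = Interpretation.δ I , Interpretation.εq I , Interpretation.λt I

module _ {m} {L₁ L₂ : LinOrd} (I : Interpretation m L₁) (J : Interpretation m L₂) where
  private
    module I = Interpretation I
    module J = Interpretation J
    module L₁ = LinOrd L₁
    module L₂ = LinOrd L₂

  same-formulas⇒≅ : formulas I ≡ formulas J → L₁ ≅ L₂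
  same-formulas⇒≅ same = record { to = h ; mono = mono ; surjective = surjective }
    where
    transport : ∀ {φ ψ} → φ ≡ ψ → (ρ : Env) → Sat φ ρ → Sat ψ ρ
    transport eq ρ = subst (λ φ → Sat φ ρ) eq

    δ≡ : I.δ ≡ J.δ
    δ≡ = cong proj₁ same
    ε≡ : I.εq ≡ J.εq
    ε≡ = cong (proj₁ ∘ proj₂) same
    λ≡ : I.λt ≡ J.λt
    λ≡ = cong (proj₂ ∘ proj₂) same

    D⇒ : ∀ x → I.D x → J.D x
    D⇒ x = transport δ≡ (envL (Vec.toList x))

    D⇐ : ∀ x → J.D x → I.D x
    D⇐ x = transport (sym δ≡) (envL (Vec.toList x))

    image : ∀ x → I.D x → L₂.Carrier
    image x dx = J.f x (D⇒ x dx)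

    image-mono : ∀ x y (dx : I.D x) (dy : I.D y) → I.f x dx L₁.<ₗ I.f y dy → image x dx L₂.<ₗ image y dy
    image-mono x y dx dy p =
      J.f-ord₁ x y (D⇒ x dx) (D⇒ y dy) (transport λ≡ (envL (Vec.toList (x Vec.++ y))) (I.f-ord₂ x y dx dy p))

    image-ker : ∀ x y (dx : I.D x) (dy : J.D y) → I.f x dx ≡ I.f y (D⇐ y dy) → image x dx ≡ J.f y dy
    image-ker x y dx dy eq =
      J.f-ker₁ x y (D⇒ x dx) dy (transport ε≡ (envL (Vec.toList (x Vec.++ y))) (I.f-ker₂ x y dx (D⇐ y dy) eq))

    h : L₁.Carrier → L₂.Carrier
    h l = let (x , dx , _) = I.f-surj l in image x dx

    mono : ∀ {a b} → a L₁.<ₗ b → h a L₂.<ₗ h b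
    mono {a} {b} a<b =
      let (x , dx , fx≡a) = I.f-surj a
          (y , dy , fy≡b) = I.f-surj b
      in image-mono x y dx dy (subst₂ L₁._<ₗ_ (sym fx≡a) (sym fy≡b) a<b)

    surjective : ∀ y → ∃ λ l → h l ≡ y
    surjective y with J.f-surj y
    ... | x , dx , refl =
      let l = I.f x (D⇐ x dx)
          (x′ , dx′ , fx′≡l) = I.f-surj l
      in l , image-ker x′ x dx′ dx fx′≡l

data Tree : Set where
  node : ℕ → List Tree → Tree

-- prefix-free binary code, with ℕᵇ used as a list of bits
unary : ℕ → ℕᵇ → ℕᵇ
unary zero    r = 1+[2 r ]
unary (suc n) r = 2[1+ unary n r ]

mutual
  treeBits : Tree → ℕᵇ → ℕᵇ
  treeBits (node n ts) r = unary n (forestBits ts r)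

  forestBits : List Tree → ℕᵇ → ℕᵇ
  forestBits []       r = 1+[2 r ]
  forestBits (t ∷ ts) r = 2[1+ treeBits t (forestBits ts r) ]

private
  2[1+]-injective : ∀ {x y} → 2[1+ x ] ≡ 2[1+ y ] → x ≡ y
  2[1+]-injective refl = refl

  1+[2]-injective : ∀ {x y} → 1+[2 x ] ≡ 1+[2 y ] → x ≡ y
  1+[2]-injective refl = refl

unary-injective : ∀ m n {r r′} → unary m r ≡ unary n r′ → m ≡ n × r ≡ r′
unary-injective zero    zero    eq = refl , 1+[2]-injective eq
unary-injective (suc m) (suc n) eq with unary-injective m n (2[1+]-injective eq)
... | refl , r≡r′ = refl , r≡r′
unary-injective zero    (suc n) ()
unary-injective (suc m) zero    ()

mutual
  treeBits-injective : ∀ t t′ {r r′} → treeBits t r ≡ treeBits t′ r′ → t ≡ t′ × r ≡ r′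
  treeBits-injective (node n ts) (node n′ ts′) eq with unary-injective n n′ eq
  ... | refl , eq′ with forestBits-injective ts ts′ eq′
  ...   | refl , r≡r′ = refl , r≡r′

  forestBits-injective : ∀ ts ts′ {r r′} → forestBits ts r ≡ forestBits ts′ r′ → ts ≡ ts′ × r ≡ r′
  forestBits-injective []       []         eq = refl , 1+[2]-injective eq
  forestBits-injective (t ∷ ts) (t′ ∷ ts′) eq with treeBits-injective t t′ (2[1+]-injective eq)
  ... | refl , eq′ with forestBits-injective ts ts′ eq′
  ...   | refl , r≡r′ = refl , r≡r′
  forestBits-injective []      (_ ∷ _) ()
  forestBits-injective (_ ∷ _) []      ()

termTree : Term → Tree
termTree (var i) = node 0 [ node i [] ]
termTree (s ⊕ t) = node 1 (termTree s ∷ termTree t ∷ [])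

treeTerm : Tree → Maybe Term
treeTerm (node 0 (node i [] ∷ []))  = just (var i)
treeTerm (node 1 (s ∷ t ∷ []))      = zipWith _⊕_ (treeTerm s) (treeTerm t)
treeTerm _                         = nothing

treeTerm-termTree : ∀ t → treeTerm (termTree t) ≡ just t
treeTerm-termTree (var i) = refl
treeTerm-termTree (s ⊕ t) rewrite treeTerm-termTree s | treeTerm-termTree t = refl

formulaTree : Formula → Tree
formulaTree (s ≐ t)  = node 0 (termTree s ∷ termTree t ∷ [])
formulaTree ff       = node 1 []
formulaTree tt       = node 2 []
formulaTree (¬f φ)   = node 3 [ formulaTree φ ]
formulaTree (φ ∧f ψ) = node 4 (formulaTree φ ∷ formulaTree ψ ∷ [])
formulaTree (φ ∨f ψ) = node 5 (formulaTree φ ∷ formulaTree ψ ∷ [])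
formulaTree (φ ⇒f ψ) = node 6 (formulaTree φ ∷ formulaTree ψ ∷ [])
formulaTree (∀f φ)   = node 7 [ formulaTree φ ]
formulaTree (∃f φ)   = node 8 [ formulaTree φ ]

treeFormula : Tree → Maybe Formula
treeFormula (node 0 (s ∷ t ∷ [])) = zipWith _≐_ (treeTerm s) (treeTerm t)
treeFormula (node 1 [])           = just ff
treeFormula (node 2 [])           = just tt
treeFormula (node 3 (φ ∷ []))     = Maybe.map ¬f_ (treeFormula φ)
treeFormula (node 4 (φ ∷ ψ ∷ [])) = zipWith _∧f_ (treeFormula φ) (treeFormula ψ)
treeFormula (node 5 (φ ∷ ψ ∷ [])) = zipWith _∨f_ (treeFormula φ) (treeFormula ψ)
treeFormula (node 6 (φ ∷ ψ ∷ [])) = zipWith _⇒f_ (treeFormula φ) (treeFormula ψ)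
treeFormula (node 7 (φ ∷ []))     = Maybe.map ∀f (treeFormula φ)
treeFormula (node 8 (φ ∷ []))     = Maybe.map ∃f (treeFormula φ)
treeFormula _                     = nothing

treeFormula-formulaTree : ∀ φ → treeFormula (formulaTree φ) ≡ just φ
treeFormula-formulaTree (s ≐ t)  rewrite treeTerm-termTree s | treeTerm-termTree t = refl
treeFormula-formulaTree ff       = refl
treeFormula-formulaTree tt       = refl
treeFormula-formulaTree (¬f φ)   rewrite treeFormula-formulaTree φ = refl
treeFormula-formulaTree (φ ∧f ψ) rewrite treeFormula-formulaTree φ | treeFormula-formulaTree ψ = refl
treeFormula-formulaTree (φ ∨f ψ) rewrite treeFormula-formulaTree φ | treeFormula-formulaTree ψ = refl
treeFormula-formulaTree (φ ⇒f ψ) rewrite treeFormula-formulaTree φ | treeFormula-formulaTree ψ = refl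
treeFormula-formulaTree (∀f φ)   rewrite treeFormula-formulaTree φ = refl
treeFormula-formulaTree (∃f φ)   rewrite treeFormula-formulaTree φ = refl

descriptionTree : ℕ × Formulas → Tree
descriptionTree (m , δ , ε , λ′) = node m (formulaTree δ ∷ formulaTree ε ∷ formulaTree λ′ ∷ [])

treeDescription : Tree → Maybe (ℕ × Formulas)
treeDescription (node m (δ ∷ ε ∷ λ′ ∷ [])) =
  Maybe.map (m ,_) (zipWith _,_ (treeFormula δ) (zipWith _,_ (treeFormula ε) (treeFormula λ′)))
treeDescription _ = nothing

treeDescription-descriptionTree : ∀ d → treeDescription (descriptionTree d) ≡ just d
treeDescription-descriptionTree (m , δ , ε , λ′)
  rewrite treeFormula-formulaTree δ | treeFormula-formulaTree ε | treeFormula-formulaTree λ′ = refl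

godelNumber : ℕ × Formulas → ℕ
godelNumber d = toℕᵇ (treeBits (descriptionTree d) zeroᵇ)

godelNumber-injective : ∀ {d d′} → godelNumber d ≡ godelNumber d′ → d ≡ d′
godelNumber-injective {d} {d′} eq = just-injective (begin
  just d                                  ≡⟨ treeDescription-descriptionTree d ⟨
  treeDescription (descriptionTree d)     ≡⟨ cong treeDescription same-tree ⟩
  treeDescription (descriptionTree d′)    ≡⟨ treeDescription-descriptionTree d′ ⟩
  just d′                                 ∎)
  where
  open ≡-Reasoning
  same-tree : descriptionTree d ≡ descriptionTree d′
  same-tree = proj₁ (treeBits-injective (descriptionTree d) (descriptionTree d′) (toℕᵇ-injective eq))

module Diagonal (em : ExcludedMiddle (Level.suc 0ℓ)) where

  Realized : ℕ → Set
  Realized n = ∃ λ t → ∃ λ m → Σ (Interpretation m (Blocks.order t)) λ I →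
               godelNumber (m , formulas I) ≡ n × t n ≡ true

  diagonal : ℕ → Bool
  diagonal n = not (does (decide em (Realized n)))

  realized⇒component : ∀ {m} (J : Interpretation m (Blocks.order diagonal)) →
    let n = godelNumber (m , formulas J) in Realized n → HasFiniteComponent (Blocks.order diagonal) n
  realized⇒component {m} J (t , m′ , I , same , tn)
    with godelNumber-injective {m′ , formulas I} {m , formulas J} same
  ... | same-description with ,-injectiveˡ same-description
  ...   | refl = HasFiniteComponent-preserved (same-formulas⇒≅ I J (,-injectiveʳ same-description)) _
                   (Blocks.component-of-block t _ tn)

  not-interpretable : ¬ Interpretable (Blocks.order diagonal)
  not-interpretable (m , _ , J) = refute (decide em (Realized n)) refl
    where
    n : ℕ
    n = godelNumber (m , formulas J)
    refute : (d : Dec (Realized n)) → diagonal n ≡ not (does d) → ⊥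
    refute (no unrealized) diag≡ = unrealized (diagonal , m , J , refl , diag≡)
    refute (yes realized)  diag≡
      with trans (sym (Blocks.block-of-component diagonal n (realized⇒component J realized))) diag≡
    ... | ()

mainTheorem1 : ExcludedMiddle (Level.suc 0ℓ) →
    ((L : LinOrd) → Scattered L → HasVDRank L 1 → Interpretation 1 L)
    × (Σ LinOrd λ L → Scattered L × HasVDRank L 2 × ¬ Interpretable L)
mainTheorem1 em = rank-1 , rank-2
  where
  rank-1 : (L : LinOrd) → Scattered L → HasVDRank L 1 → Interpretation 1 L
  rank-1 L _ (finitely-many-classes , _) =
    ChainInterpretation.interpretation em
      (ChainsOfRepresentatives.chainDecomposition em
        (finitely-many-classes⇒representatives em L finitely-many-classes))
  rank-2 : Σ LinOrd λ L → Scattered L × HasVDRank L 2 × ¬ Interpretable L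
  rank-2 = Blocks.order diagonal , BlocksRank.scattered diagonal , BlocksRank.has-rank-2 diagonal ,
           not-interpretable
    where open Diagonal em
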